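{- Let $\mathbf{A}$ be any (possibly empty) composition of the operators $\mathbf{S}$ and $\mathbf{R}$. Then for every $n$, the number of permutations of $[n]$ sorted by $\mathbf{S}\circ\mathbf{A}$ equals the number of permutations of $[n]$ sorted by $\mathbf{S}\circ\mathbf{R}\circ\mathbf{A}$. Moreover, the following statistics are equidistributed across these two sets: the number and positions of the right-to-left maxima, the number and positions of the left-to-right maxima, and the up-down word (hence every statistic determined by the up-down word). If $\mathbf{A}=\mathbf{A}_0\circ\mathbf{S}$ for some composition $\mathbf{A}_0$ of operators from $\{\mathbf{S},\mathbf{R}\}$, the statistic $\mathrm{zeil}$ is also equidistributed. If $\mathbf{A}=\mathbf{B}_0\circ\mathbf{S}\circ\mathbf{R}\circ\mathbf{S}^k$ for some composition $\mathbf{B}_0$ and some $k\ge 1$, the statistic $\mathrm{Rzeil}$ is also equidistributed. More precisely, the map $\Phi_{\mathbf{A}}$ is a size-preserving bijection from the set of permutations sorted by $\mathbf{S}\circ\mathbf{A}$ onto the set of permutations sorted by $\mathbf{S}\circ\mathbf{R}\circ\mathbf{A}$, and it preserves each of the statistics listed above, under the corresponding hypotheses on $\mathbf{A}$.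
   Context: Notation and conventions. - Permutations of $[n]=\{1,\dots,n\}$ are written in one-line notation $\sigma=\sigma(1)\cdots\sigma(n)$, and composition is $(\lambda\circ\sigma)(i)=\lambda(\sigma(i))$. - A sequence of distinct integers is identified with the permutation order-isomorphic to it; $n$ denotes the maximum entry. - $\sigma$ contains the pattern $\pi$ of size $k$ if there exist indices $i_1<\dots<i_k$ such that $\sigma(i_1)\cdots\sigma(i_k)$ is order-isomorphic to $\pi$; otherwise $\sigma$ avoids $\pi$. $\mathrm{Av}(B)$ is the set of permutations avoiding every pattern in $B$. Operators. - The stack-sorting operator is defined by $\mathbf{S}(\varepsilon)=\varepsilon$ and $\mathbf{S}(\alpha n\beta)=\mathbf{S}(\alpha)\mathbf{S}(\beta)n$, where $n$ is the maximum entry. - $\mathbf{R}$ is reversal: $\mathbf{R}(\sigma)(i)=\sigma(n+1-i)$. - A composition of operators from $\{\mathbf{S},\mathbf{R}\}$ is any finite composition of them; the empty composition is the identity. - A permutation $\theta$ is sorted by $\mathbf{S}\circ\mathbf{A}$ if $\mathbf{S}(\mathbf{A}(\theta))$ is the identity permutation. By Knuth, $\mathbf{S}(\sigma)$ is the identity iff $\sigma\in\mathrm{Av}(231)$. The bijection $P$. - For $\alpha$ of size $a$ and $\beta$ of size $b$: $\alpha\oplus\beta=\alpha\,(\beta+a)$ and $\alpha\ominus\beta=(\alpha+b)\,\beta$, where $\beta+a$ adds $a$ to every entry. - Every nonempty $\pi\in\mathrm{Av}(231)$ is uniquely $\alpha\oplus(1\ominus\beta)$ with $\alpha,\beta\in\mathrm{Av}(231)$,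 possibly empty. - $P:\mathrm{Av}(231)\to\mathrm{Av}(132)$ is defined by $P(\varepsilon)=\varepsilon$ and $P(\alpha\oplus(1\ominus\beta))=(P(\alpha)\oplus 1)\ominus P(\beta)$. - For $\pi\in\mathrm{Av}(231)$ of size $n$, $\lambda_\pi$ is the permutation of $[n]$ with $P(\pi)=\lambda_\pi\circ\pi$. - For $\theta$ sorted by $\mathbf{S}\circ\mathbf{A}$, so that $\mathbf{A}(\theta)\in\mathrm{Av}(231)$, set $\Phi_{\mathbf{A}}(\theta)=\lambda_{\mathbf{A}(\theta)}\circ\theta$. Statistics. - A left-to-right (resp. right-to-left) maximum of $\pi$ is an entry $\pi(i)$ larger than all $\pi(j)$ with $j<i$ (resp. $j>i$). - The up-down word of $\pi$ is $w\in\{u,d\}^{n-1}$ with $w(i)=u$ if $\pi(i)<\pi(i+1)$ and $w(i)=d$ otherwise. - $\mathrm{zeil}(\pi)=\max\{k : n(n-1)\cdots(n-k+1)\text{ is a subsequence of }\pi\}$ and $\mathrm{Rzeil}(\pi)=\max\{k : (n-k+1)\cdots(n-1)n\text{ is a subsequence of }\pi\}$. -}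

module Defs where

open import Data.Nat using (ℕ; zero; suc; _+_; _∸_; _⊔_; _<ᵇ_; _≡ᵇ_; _≤_)
open import Data.Nat.Properties using (_≟_)
open import Data.Bool using (Bool; true; false; if_then_else_)
open import Data.List using (List; []; _∷_; _++_; [_]; map; length; reverse; upTo; foldr)
open import Data.List.Relation.Binary.Permutation.Propositional using (_↭_)
open import Data.List.Relation.Binary.Sublist.DecPropositional _≟_ using (_⊆_; _⊆?_)
open import Relation.Nullary using (does)
open import Relation.Binary.PropositionalEquality using (_≡_)

idPerm : ℕ → List ℕ
idPerm n = map suc (upTo n)

IsPerm : ℕ → List ℕ → Set
IsPerm n θ = θ ↭ idPerm n

maxL : List ℕ → ℕ
maxL = foldr _⊔_ 0

before : ℕ → List ℕ → List ℕ
before m [] = []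
before m (x ∷ xs) = if x ≡ᵇ m then [] else x ∷ before m xs

after : ℕ → List ℕ → List ℕ
after m [] = []
after m (x ∷ xs) = if x ≡ᵇ m then xs else after m xs

indexOf : ℕ → List ℕ → ℕ
indexOf v [] = 0
indexOf v (x ∷ xs) = if x ≡ᵇ v then 0 else suc (indexOf v xs)

-- 0-based lookup (default 0)
at : List ℕ → ℕ → ℕ
at [] i = 0
at (x ∷ xs) zero = x
at (x ∷ xs) (suc i) = at xs i

-- Stack-sorting S(α n β) = S(α) S(β) n  (fuel = length, always enough)

stackSortF : ℕ → List ℕ → List ℕ
stackSortF zero l = []
stackSortF (suc f) [] = []
stackSortF (suc f) l@(_ ∷ _) =
  stackSortF f (before (maxL l) l) ++ stackSortF f (after (maxL l) l) ++ [ maxL l ]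

stackSort : List ℕ → List ℕ
stackSort l = stackSortF (length l) l

rev : List ℕ → List ℕ
rev = reverse

data Op : Set where
  S R : Op

op : Op → List ℕ → List ℕ
op S = stackSort
op R = rev

-- the list o₁ ∷ o₂ ∷ ... ∷ oₖ denotes o₁ ∘ o₂ ∘ ... ∘ oₖ; [] is the identity
Comp : Set
Comp = List Op

apply : Comp → List ℕ → List ℕ
apply [] θ = θ
apply (o ∷ os) θ = op o (apply os θ)

SortedBy : Comp → ℕ → List ℕ → Set
SortedBy A n θ = stackSort (apply A θ) ≡ idPerm n

-- The bijection P : Av(231) → Av(132).
-- For π = α ⊕ (1 ⊖ β) (the maximum n sits right after α, α has values
-- 1..a, β+a follows), P(π) = (P(α) ⊕ 1) ⊖ P(β) = (P(α)+b) n P(β).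

PF : ℕ → List ℕ → List ℕ
PF zero l = []
PF (suc f) [] = []
PF (suc f) l@(_ ∷ _) =
  let m  = maxL l
      α  = before m l
      a  = length α
      β  = map (λ x → x ∸ a) (after m l)
      b  = length β
  in map (λ x → x + b) (PF f α) ++ m ∷ PF f β

P : List ℕ → List ℕ
P π = PF (length π) π

-- λ_π with P(π) = λ_π ∘ π, i.e. λ_π(π(i)) = P(π)(i)
lam : List ℕ → ℕ → ℕ
lam π v = at (P π) (indexOf v π)

Φ : Comp → List ℕ → List ℕ
Φ A θ = map (lam (apply A θ)) θ

allB : (ℕ → Bool) → List ℕ → Bool
allB p [] = true
allB p (x ∷ xs) = if p x then allB p xs else false

rlMaxMask : List ℕ → List Bool
rlMaxMask [] = []
rlMaxMask (x ∷ xs) = allB (λ y → y <ᵇ x) xs ∷ rlMaxMask xs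

lrMaxMaskFrom : List ℕ → List ℕ → List Bool
lrMaxMaskFrom seen [] = []
lrMaxMaskFrom seen (x ∷ xs) = allB (λ y → y <ᵇ x) seen ∷ lrMaxMaskFrom (x ∷ seen) xs

lrMaxMask : List ℕ → List Bool
lrMaxMask = lrMaxMaskFrom []

data UD : Set where
  u d : UD

upDown : List ℕ → List UD
upDown (x ∷ y ∷ xs) = (if x <ᵇ y then u else d) ∷ upDown (y ∷ xs)
upDown _ = []

decRun : ℕ → ℕ → List ℕ
decRun n k = map (λ i → n ∸ i) (upTo k)

incRun : ℕ → ℕ → List ℕ
incRun n k = reverse (decRun n k)

maxWhere : ℕ → (ℕ → Bool) → ℕ
maxWhere N p = maxL (map (λ k → if p k then k else 0) (upTo (suc N)))

-- zeil(π) = max{k : n(n-1)...(n-k+1) is a subsequence of π}, n = max entry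
-- (k ≤ length π necessarily, since a subsequence is no longer than π)
zeil : List ℕ → ℕ
zeil π = maxWhere (length π) (λ k → does (decRun (maxL π) k ⊆? π))

Rzeil : List ℕ → ℕ
Rzeil π = maxWhere (length π) (λ k → does (incRun (maxL π) k ⊆? π))

-- For π ∈ Av(231), π and P(π) have decreasing binary trees of the same shape, so λ_π sends
-- each entry of π to the entry of P(π) at the same node and preserves the ancestor relation.
-- A relabelling that preserves ancestry commutes with S and R, and every ancestor pair of θ
-- is one of S(θ) and of R(θ). Hence λ = λ_{A(θ)} preserves ancestry on θ and on every
-- intermediate list, so A(λ ∘ θ) = λ ∘ A(θ) = P(A(θ)), whose reverse is stack-sortable; the
-- inverse of P inverts Φ_A. Adjacent entries, and an entry together with the first larger
-- entry on either side, are ancestor-related, so the up-down word and both kinds of maxima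
-- are preserved. Finally n (n-1) … (n-k+1) is a subsequence iff n-k+1, …, n are
-- right-to-left maxima; if λ also preserves ancestry on the stack-sorted list, it must fix
-- these top values, which transfers zeil (and, after reversal, Rzeil, since S keeps an
-- increasing run (n-k+1) … n of top values).

module Submission where

open import Defs
open import Data.Nat using (ℕ; suc; _≥_)
open import Data.List using (List; _∷_; []; _++_; replicate)
open import Data.Product using (_×_; Σ; ∃; _,_)
open import Data.Product using (proj₁; proj₂)
open import Relation.Binary.PropositionalEquality using (_≡_)
open import Data.Nat using (zero; _+_; _∸_; _⊔_; _<ᵇ_; _≡ᵇ_; _≤_; _<_; z≤n; s≤s; s≤s⁻¹)
open import Data.Nat.Properties
open import Data.Bool using (true; false; if_then_else_; T)
open import Data.List using ([_]; map; length; reverse; upTo; applyUpTo)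
open import Data.List.Properties
open import Data.List.Relation.Unary.All as All using (All; []; _∷_)
import Data.List.Relation.Unary.All.Properties as All
open import Data.List.Relation.Unary.Any using (here; there)
open import Data.List.Membership.Propositional using (_∈_; _∉_; find)
open import Data.List.Membership.Propositional.Properties
open import Data.List.Relation.Binary.Permutation.Propositional as Perm
  using (_↭_; ↭-sym; ↭-trans; ↭-refl; prep; swap)
import Data.List.Relation.Binary.Permutation.Propositional.Properties as ↭
open import Data.List.Relation.Binary.Sublist.Propositional using (_⊆_; _∷_; _∷ʳ_) renaming (lookup to ⊆-lookup)
import Data.List.Relation.Binary.Sublist.Propositional.Properties as ⊆
open import Data.List.Relation.Binary.Sublist.DecPropositional _≟_ using (_⊆?_)
open import Data.Sum using (_⊎_; inj₁; inj₂)
open import Function using (_∘_; _⇔_; mk⇔)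
open import Relation.Nullary using (¬_; yes; no; does; contradiction)
open import Relation.Nullary.Decidable using (does-⇔)
open import Relation.Nullary.Reflects using (ofʸ; ofⁿ)
open import Relation.Binary.Definitions using (tri<; tri≈; tri>)
open import Relation.Binary.PropositionalEquality
  using (_≢_; refl; sym; trans; cong; cong₂; subst; subst₂; module ≡-Reasoning)

++-∷-compare : ∀ (a : List ℕ) x b c y z → a ++ x ∷ b ≡ c ++ y ∷ z →
  (Σ (List ℕ) λ e → c ≡ a ++ x ∷ e × b ≡ e ++ y ∷ z)
  ⊎ (a ≡ c × x ≡ y × b ≡ z)
  ⊎ (Σ (List ℕ) λ e → a ≡ c ++ y ∷ e × z ≡ e ++ x ∷ b)
++-∷-compare [] x b [] y z refl = inj₂ (inj₁ (refl , refl , refl))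
++-∷-compare [] x b (c ∷ cs) y z refl = inj₁ (cs , refl , refl)
++-∷-compare (a ∷ as) x b [] y z refl = inj₂ (inj₂ (as , refl , refl))
++-∷-compare (a ∷ as) x b (c ∷ cs) y z eq with refl , eq′ ← ∷-injective eq
  with ++-∷-compare as x b cs y z eq′
... | inj₁ (e , p , q) = inj₁ (e , cong (a ∷_) p , q)
... | inj₂ (inj₁ (p , q , r)) = inj₂ (inj₁ (cong (a ∷_) p , q , r))
... | inj₂ (inj₂ (e , p , q)) = inj₂ (inj₂ (e , cong (a ∷_) p , q))

++-∷-≢[] : ∀ (a : List ℕ) {x b} → a ++ x ∷ b ≢ []
++-∷-≢[] [] ()
++-∷-≢[] (_ ∷ _) ()

length-++-∷ : ∀ (a : List ℕ) x b → length (a ++ x ∷ b) ≡ suc (length a + length b)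
length-++-∷ a x b = trans (length-++ a) (+-suc (length a) (length b))

++-injectiveˡ : ∀ (a : List ℕ) {b c d} → length a ≡ length c → a ++ b ≡ c ++ d → a ≡ c × b ≡ d
++-injectiveˡ [] {c = []} _ eq = refl , eq
++-injectiveˡ (x ∷ a) {c = y ∷ c} len eq with refl , eq′ ← ∷-injective eq
  with refl , b≡d ← ++-injectiveˡ a {c = c} (suc-injective len) eq′ = refl , b≡d

++-∷-injective : ∀ (a : List ℕ) {x b c y z} → length a ≡ length c →
  a ++ x ∷ b ≡ c ++ y ∷ z → a ≡ c × x ≡ y × b ≡ z
++-∷-injective a len eq with a≡c , eq′ ← ++-injectiveˡ a len eq = a≡c , ∷-injective eq′

reverse-++-∷ : ∀ (a : List ℕ) x b → reverse (a ++ x ∷ b) ≡ reverse b ++ x ∷ reverse a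
reverse-++-∷ a x b = begin
  reverse (a ++ x ∷ b)             ≡⟨ reverse-++ a (x ∷ b) ⟩
  reverse (x ∷ b) ++ reverse a     ≡⟨ cong (_++ reverse a) (unfold-reverse x b) ⟩
  (reverse b ++ [ x ]) ++ reverse a ≡⟨ ++-assoc (reverse b) [ x ] (reverse a) ⟩
  reverse b ++ x ∷ reverse a       ∎
  where open ≡-Reasoning

≡ᵇ-refl : ∀ m → (m ≡ᵇ m) ≡ true
≡ᵇ-refl m with m ≡ᵇ m in eq
... | true = refl
... | false = contradiction (≡⇒≡ᵇ m m refl) (subst T eq)

≢⇒≡ᵇ-false : ∀ x m → x ≢ m → (x ≡ᵇ m) ≡ false
≢⇒≡ᵇ-false x m x≢m with x ≡ᵇ m in eq
... | false = refl
... | true = contradiction (≡ᵇ⇒≡ x m (subst T (sym eq) _)) x≢m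

<⇒<ᵇ-true : ∀ {x y} → x < y → (x <ᵇ y) ≡ true
<⇒<ᵇ-true {x} {y} x<y with x <ᵇ y | <ᵇ-reflects-< x y
... | true | _ = refl
... | false | ofⁿ x≮y = contradiction x<y x≮y

≮⇒<ᵇ-false : ∀ {x y} → ¬ x < y → (x <ᵇ y) ≡ false
≮⇒<ᵇ-false {x} {y} x≮y with x <ᵇ y | <ᵇ-reflects-< x y
... | false | _ = refl
... | true | ofʸ x<y = contradiction x<y x≮y

allB<ᵇ-true : ∀ {x} q → All (_< x) q → allB (λ y → y <ᵇ x) q ≡ true
allB<ᵇ-true [] [] = refl
allB<ᵇ-true (_ ∷ q) (y<x ∷ q<x) rewrite <⇒<ᵇ-true y<x = allB<ᵇ-true q q<x

allB<ᵇ-true⁻ : ∀ {x} q → allB (λ y → y <ᵇ x) q ≡ true → All (_< x) q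
allB<ᵇ-true⁻ [] _ = []
allB<ᵇ-true⁻ {x} (y ∷ q) eq with y <ᵇ x | <ᵇ-reflects-< y x
... | true | ofʸ y<x = y<x ∷ allB<ᵇ-true⁻ q eq
... | false | _ = contradiction eq λ ()

maxL-lub : ∀ {m} l → All (_≤ m) l → maxL l ≤ m
maxL-lub [] [] = z≤n
maxL-lub (x ∷ l) (x≤m ∷ l≤m) = ⊔-lub x≤m (maxL-lub l l≤m)

maxL-∈ : ∀ x xs → maxL (x ∷ xs) ∈ x ∷ xs
maxL-∈ x [] = here (⊔-identityʳ x)
maxL-∈ x (y ∷ ys) with ⊔-sel x (maxL (y ∷ ys))
... | inj₁ eq = here eq
... | inj₂ eq = there (subst (_∈ y ∷ ys) (sym eq) (maxL-∈ y ys))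

∈⇒≤maxL : ∀ {x} l → x ∈ l → x ≤ maxL l
∈⇒≤maxL (y ∷ l) (here refl) = m≤m⊔n y (maxL l)
∈⇒≤maxL (y ∷ l) (there p) = ≤-trans (∈⇒≤maxL l p) (m≤n⊔m y (maxL l))

maxL-++-∷ : ∀ {m} α β → All (_< m) α → All (_< m) β → maxL (α ++ m ∷ β) ≡ m
maxL-++-∷ [] β _ β<m = m≥n⇒m⊔n≡m (maxL-lub β (All.map <⇒≤ β<m))
maxL-++-∷ (a ∷ α) β (a<m ∷ α<m) β<m =
  trans (cong (a ⊔_) (maxL-++-∷ α β α<m β<m)) (m≤n⇒m⊔n≡n (<⇒≤ a<m))

before-++-∷ : ∀ {m} α β → All (_< m) α → before m (α ++ m ∷ β) ≡ α
before-++-∷ {m} [] β _ rewrite ≡ᵇ-refl m = refl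
before-++-∷ {m} (a ∷ α) β (a<m ∷ α<m) rewrite ≢⇒≡ᵇ-false a m (<⇒≢ a<m) =
  cong (a ∷_) (before-++-∷ α β α<m)

after-++-∷ : ∀ {m} α β → All (_< m) α → after m (α ++ m ∷ β) ≡ β
after-++-∷ {m} [] β _ rewrite ≡ᵇ-refl m = refl
after-++-∷ {m} (a ∷ α) β (a<m ∷ α<m) rewrite ≢⇒≡ᵇ-false a m (<⇒≢ a<m) = after-++-∷ α β α<m

length-before-after : ∀ m l → m ∈ l → suc (length (before m l) + length (after m l)) ≡ length l
length-before-after m (x ∷ l) m∈ with x ≡ᵇ m in eq
... | true = refl
length-before-after m (x ∷ l) (here refl) | false = contradiction (≡⇒≡ᵇ x x refl) (subst T eq)
length-before-after m (x ∷ l) (there m∈) | false = cong suc (length-before-after m l m∈)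

module _ (x : ℕ) (xs : List ℕ) {f : ℕ} (len≤ : length (x ∷ xs) ≤ suc f) where

  private
    split-length = length-before-after _ (x ∷ xs) (maxL-∈ x xs)

  length-before-maxL≤ : length (before (maxL (x ∷ xs)) (x ∷ xs)) ≤ f
  length-before-maxL≤ = s≤s⁻¹ (≤-trans (s≤s (m≤m+n _ _)) (≤-trans (≤-reflexive split-length) len≤))

  length-after-maxL≤ : length (after (maxL (x ∷ xs)) (x ∷ xs)) ≤ f
  length-after-maxL≤ = s≤s⁻¹ (≤-trans (s≤s (m≤n+m _ _)) (≤-trans (≤-reflexive split-length) len≤))

data DecTree : List ℕ → Set where
  leaf : DecTree []
  node : ∀ {α β m} → All (_< m) α → All (_< m) β → DecTree α → DecTree β → DecTree (α ++ m ∷ β)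

stackSortF-suc : ∀ f {l} → l ≢ [] →
  stackSortF (suc f) l ≡ stackSortF f (before (maxL l) l) ++ stackSortF f (after (maxL l) l) ++ [ maxL l ]
stackSortF-suc f {[]} l≢[] = contradiction refl l≢[]
stackSortF-suc f {_ ∷ _} _ = refl

stackSortF-fuel : ∀ f g l → length l ≤ f → length l ≤ g → stackSortF f l ≡ stackSortF g l
stackSortF-fuel zero zero l _ _ = refl
stackSortF-fuel zero (suc g) [] _ _ = refl
stackSortF-fuel (suc f) zero [] _ _ = refl
stackSortF-fuel (suc f) (suc g) [] _ _ = refl
stackSortF-fuel (suc f) (suc g) (x ∷ xs) p q =
  cong₂ _++_ (stackSortF-fuel f g _ (length-before-maxL≤ x xs p) (length-before-maxL≤ x xs q))
    (cong (_++ _) (stackSortF-fuel f g _ (length-after-maxL≤ x xs p) (length-after-maxL≤ x xs q)))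

stackSort-++-∷ : ∀ {m} α β → All (_< m) α → All (_< m) β →
  stackSort (α ++ m ∷ β) ≡ stackSort α ++ stackSort β ++ [ m ]
stackSort-++-∷ {m} α β α<m β<m = begin
    stackSortF (length L) L
  ≡⟨ cong (λ k → stackSortF k L) (length-++-∷ α m β) ⟩
    stackSortF (suc K) L
  ≡⟨ stackSortF-suc K (++-∷-≢[] α) ⟩
    stackSortF K (before (maxL L) L) ++ stackSortF K (after (maxL L) L) ++ [ maxL L ]
  ≡⟨ cong (λ z → stackSortF K (before z L) ++ stackSortF K (after z L) ++ [ z ]) (maxL-++-∷ α β α<m β<m) ⟩
    stackSortF K (before m L) ++ stackSortF K (after m L) ++ [ m ]
  ≡⟨ cong₂ (λ u v → stackSortF K u ++ stackSortF K v ++ [ m ]) (before-++-∷ α β α<m) (after-++-∷ α β α<m) ⟩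
    stackSortF K α ++ stackSortF K β ++ [ m ]
  ≡⟨ cong₂ (λ u v → u ++ v ++ [ m ]) (stackSortF-fuel K _ α (m≤m+n _ _) ≤-refl)
                                     (stackSortF-fuel K _ β (m≤n+m _ _) ≤-refl) ⟩
    stackSort α ++ stackSort β ++ [ m ]
  ∎
  where
  open ≡-Reasoning
  L = α ++ m ∷ β
  K = length α + length β

PF-node : ℕ → ℕ → List ℕ → List ℕ → List ℕ
PF-node f m α β = map (λ x → x + length (map (λ y → y ∸ length α) β)) (PF f α) ++ m ∷ PF f (map (λ y → y ∸ length α) β)

PF-suc : ∀ f {l} → l ≢ [] → PF (suc f) l ≡ PF-node f (maxL l) (before (maxL l) l) (after (maxL l) l)
PF-suc f {[]} l≢[] = contradiction refl l≢[]
PF-suc f {_ ∷ _} _ = refl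

PF-fuel : ∀ f g l → length l ≤ f → length l ≤ g → PF f l ≡ PF g l
PF-fuel zero zero l _ _ = refl
PF-fuel zero (suc g) [] _ _ = refl
PF-fuel (suc f) zero [] _ _ = refl
PF-fuel (suc f) (suc g) [] _ _ = refl
PF-fuel (suc f) (suc g) l@(x ∷ xs) p q =
  cong₂ (λ u v → map (λ y → y + length β′) u ++ maxL l ∷ v)
    (PF-fuel f g α (length-before-maxL≤ x xs p) (length-before-maxL≤ x xs q))
    (PF-fuel f g β′ (subst (_≤ f) (sym (length-map _ β)) (length-after-maxL≤ x xs p))
                    (subst (_≤ g) (sym (length-map _ β)) (length-after-maxL≤ x xs q)))
  where
  α = before (maxL l) l
  β = after (maxL l) l
  β′ = map (λ z → z ∸ length α) β

PF-length : ∀ f l → length l ≤ f → length (PF f l) ≡ length l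
PF-length zero [] _ = refl
PF-length (suc f) [] _ = refl
PF-length (suc f) l@(x ∷ xs) p = begin
    length (map _ (PF f α) ++ maxL l ∷ PF f β′)
  ≡⟨ length-++-∷ (map _ (PF f α)) _ (PF f β′) ⟩
    suc (length (map _ (PF f α)) + length (PF f β′))
  ≡⟨ cong₂ (λ u v → suc (u + v))
       (trans (length-map _ (PF f α)) (PF-length f α (length-before-maxL≤ x xs p)))
       (trans (PF-length f β′ (subst (_≤ f) (sym (length-map _ β)) (length-after-maxL≤ x xs p))) (length-map _ β)) ⟩
    suc (length α + length β)
  ≡⟨ length-before-after _ l (maxL-∈ x xs) ⟩
    length l
  ∎
  where
  open ≡-Reasoning
  α = before (maxL l) l
  β = after (maxL l) l
  β′ = map (λ z → z ∸ length α) β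

length-P : ∀ l → length (P l) ≡ length l
length-P l = PF-length (length l) l ≤-refl

P-++-∷ : ∀ {m} α β → All (_< m) α → All (_< m) β →
  P (α ++ m ∷ β) ≡ map (λ y → y + length β) (P α) ++ m ∷ P (map (λ z → z ∸ length α) β)
P-++-∷ {m} α β α<m β<m = begin
    PF (length L) L
  ≡⟨ cong (λ k → PF k L) (length-++-∷ α m β) ⟩
    PF (suc K) L
  ≡⟨ PF-suc K (++-∷-≢[] α) ⟩
    PF-node K (maxL L) (before (maxL L) L) (after (maxL L) L)
  ≡⟨ cong (λ z → PF-node K z (before z L) (after z L)) (maxL-++-∷ α β α<m β<m) ⟩
    PF-node K m (before m L) (after m L)
  ≡⟨ cong₂ (PF-node K m) (before-++-∷ α β α<m) (after-++-∷ α β α<m) ⟩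
    PF-node K m α β
  ≡⟨ cong₂ (λ k u → map (λ y → y + k) u ++ m ∷ PF K β′) (length-map _ β) (PF-fuel K _ α (m≤m+n _ _) ≤-refl) ⟩
    map (λ y → y + length β) (P α) ++ m ∷ PF K β′
  ≡⟨ cong (λ u → map (λ y → y + length β) (P α) ++ m ∷ u)
       (PF-fuel K _ β′ (≤-trans (≤-reflexive (length-map _ β)) (m≤n+m _ _)) ≤-refl) ⟩
    map (λ y → y + length β) (P α) ++ m ∷ P β′
  ∎
  where
  open ≡-Reasoning
  L = α ++ m ∷ β
  K = length α + length β
  β′ = map (λ z → z ∸ length α) β

length-++-∷≰0 : ∀ (α : List ℕ) {m β} → ¬ length (α ++ m ∷ β) ≤ 0
length-++-∷≰0 α {m} {β} len = contradiction (≤-trans (≤-reflexive (sym (length-++-∷ α m β))) len) λ ()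

module _ (α : List ℕ) {m β k} (len≤ : length (α ++ m ∷ β) ≤ suc k) where

  private
    len′ = ≤-trans (≤-reflexive (sym (length-++-∷ α m β))) len≤

  length-left≤ : length α ≤ k
  length-left≤ = s≤s⁻¹ (≤-trans (s≤s (m≤m+n _ _)) len′)

  length-right≤ : length β ≤ k
  length-right≤ = s≤s⁻¹ (≤-trans (s≤s (m≤n+m _ _)) len′)

  length-map-right≤ : ∀ (h : ℕ → ℕ) → length (map h β) ≤ k
  length-map-right≤ h = ≤-trans (≤-reflexive (length-map h β)) length-right≤

data Distinct : List ℕ → Set where
  [] : Distinct []
  _∷_ : ∀ {x xs} → x ∉ xs → Distinct xs → Distinct (x ∷ xs)

Distinct-resp-↭ : ∀ {a b} → a ↭ b → Distinct a → Distinct b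
Distinct-resp-↭ Perm.refl ds = ds
Distinct-resp-↭ (prep x p) (x∉ ∷ ds) = (x∉ ∘ ↭.∈-resp-↭ (↭-sym p)) ∷ Distinct-resp-↭ p ds
Distinct-resp-↭ (swap x y p) (x∉ ∷ (y∉ ∷ ds)) =
  (λ { (here refl) → x∉ (here refl) ; (there y∈) → y∉ (↭.∈-resp-↭ (↭-sym p) y∈) })
  ∷ ((x∉ ∘ there ∘ ↭.∈-resp-↭ (↭-sym p)) ∷ Distinct-resp-↭ p ds)
Distinct-resp-↭ (Perm.trans p q) ds = Distinct-resp-↭ q (Distinct-resp-↭ p ds)

Distinct-++⁻ : ∀ a {b} → Distinct (a ++ b) → Distinct a × Distinct b
Distinct-++⁻ [] ds = [] , ds
Distinct-++⁻ (x ∷ a) (x∉ ∷ ds) = (x∉ ∘ ∈-++⁺ˡ) ∷ proj₁ (Distinct-++⁻ a ds) , proj₂ (Distinct-++⁻ a ds)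

Distinct-++-∷⁻ : ∀ a {x b} → Distinct (a ++ x ∷ b) → Distinct a × Distinct b
Distinct-++-∷⁻ a ds with da , (_ ∷ db) ← Distinct-++⁻ a ds = da , db

Distinct-disjoint : ∀ a {b y} → Distinct (a ++ b) → y ∈ a → y ∉ b
Distinct-disjoint (x ∷ a) (x∉ ∷ ds) (here refl) y∈b = x∉ (∈-++⁺ʳ a y∈b)
Distinct-disjoint (x ∷ a) (x∉ ∷ ds) (there y∈a) y∈b = Distinct-disjoint a ds y∈a y∈b

Distinct-∉ˡ : ∀ a {x b} → Distinct (a ++ x ∷ b) → x ∉ a
Distinct-∉ˡ a ds x∈a = Distinct-disjoint a ds x∈a (here refl)

Distinct-∉ʳ : ∀ a {x b} → Distinct (a ++ x ∷ b) → x ∉ b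
Distinct-∉ʳ a ds with _ , (x∉ ∷ _) ← Distinct-++⁻ a ds = x∉

Distinct-split-unique : ∀ {L} p x q p′ q′ → Distinct L → L ≡ p ++ x ∷ q → L ≡ p′ ++ x ∷ q′ →
  p ≡ p′ × q ≡ q′
Distinct-split-unique p x q p′ q′ ds refl eq with ++-∷-compare p x q p′ x q′ eq
... | inj₁ (e , refl , refl) = contradiction (∈-++⁺ʳ e (here refl)) (Distinct-∉ʳ p ds)
... | inj₂ (inj₁ (p≡p′ , _ , q≡q′)) = p≡p′ , q≡q′
... | inj₂ (inj₂ (e , refl , refl)) = contradiction (∈-++⁺ʳ p′ (here refl)) (Distinct-∉ˡ (p′ ++ x ∷ e) ds)

Distinct-reverse : ∀ {l} → Distinct l → Distinct (reverse l)
Distinct-reverse {l} = Distinct-resp-↭ (↭-sym (↭.↭-reverse l))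

Distinct-map⁺ : ∀ (f : ℕ → ℕ) {l} → (∀ {x y} → f x ≡ f y → x ≡ y) → Distinct l → Distinct (map f l)
Distinct-map⁺ f inj [] = []
Distinct-map⁺ f inj (x∉ ∷ ds) = fx∉ ∷ Distinct-map⁺ f inj ds
  where fx∉ = λ fx∈ → let (y , y∈ , fx≡fy) = ∈-map⁻ f fx∈ in x∉ (subst (_∈ _) (sym (inj fx≡fy)) y∈)

Distinct-map⁻ : ∀ (f : ℕ → ℕ) {l} → Distinct (map f l) → Distinct l
Distinct-map⁻ f {[]} [] = []
Distinct-map⁻ f {x ∷ l} (fx∉ ∷ ds) = (fx∉ ∘ ∈-map⁺ f) ∷ Distinct-map⁻ f ds

Distinct-applyUpTo : ∀ (g : ℕ → ℕ) n → (∀ {i j} → g i ≡ g j → i ≡ j) → Distinct (applyUpTo g n)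
Distinct-applyUpTo g zero inj = []
Distinct-applyUpTo g (suc n) inj = g0∉ ∷ Distinct-applyUpTo (g ∘ suc) n (suc-injective ∘ inj)
  where g0∉ = λ g0∈ → let (i , _ , g0≡) = ∈-applyUpTo⁻ (g ∘ suc) g0∈ in 0≢1+n (inj g0≡)

Distinct-idPerm : ∀ n → Distinct (idPerm n)
Distinct-idPerm n = Distinct-map⁺ suc suc-injective (Distinct-applyUpTo (λ i → i) n (λ eq → eq))

IsPerm⇒Distinct : ∀ {n l} → IsPerm n l → Distinct l
IsPerm⇒Distinct {n} p = Distinct-resp-↭ (↭-sym p) (Distinct-idPerm n)

DecTree-build : ∀ k l → length l ≤ k → Distinct l → DecTree l
DecTree-build k [] _ _ = leaf
DecTree-build (suc k) (x ∷ xs) len ds with ys , zs , eq ← ∈-∃++ (maxL-∈ x xs) =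
  subst DecTree (sym eq) (node ys<m zs<m (DecTree-build k ys ys-len dys) (DecTree-build k zs zs-len dzs))
  where
  m = maxL (x ∷ xs)
  ds′ : Distinct (ys ++ m ∷ zs)
  ds′ = subst Distinct eq ds
  dys = proj₁ (Distinct-++-∷⁻ ys ds′)
  dzs = proj₂ (Distinct-++-∷⁻ ys ds′)
  <m : ∀ {y} → y ∈ ys ++ m ∷ zs → y ≢ m → y < m
  <m y∈ = ≤∧≢⇒< (∈⇒≤maxL (x ∷ xs) (subst (_ ∈_) (sym eq) y∈))
  ys<m : All (_< m) ys
  ys<m = All.tabulate λ y∈ → <m (∈-++⁺ˡ y∈) λ { refl → Distinct-∉ˡ ys ds′ y∈ }
  zs<m : All (_< m) zs
  zs<m = All.tabulate λ z∈ → <m (∈-++⁺ʳ ys (there z∈)) λ { refl → Distinct-∉ʳ ys ds′ z∈ }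
  len′ : length (ys ++ m ∷ zs) ≤ suc k
  len′ = subst (λ l → length l ≤ suc k) eq len
  ys-len = length-left≤ ys len′
  zs-len = length-right≤ ys len′

Distinct⇒DecTree : ∀ {l} → Distinct l → DecTree l
Distinct⇒DecTree {l} = DecTree-build (length l) l ≤-refl

-- Ancestry in the decreasing binary tree

Segment : List ℕ → ℕ → List ℕ → ℕ → Set
Segment l a mid b = Σ (List ℕ) λ p → Σ (List ℕ) λ s → l ≡ p ++ a ∷ mid ++ b ∷ s

-- x is an ancestor of y in the decreasing binary tree of l (root the maximum, subtrees
-- built recursively from the entries on either side) iff y < x and everything between is below x.
Ancestor : List ℕ → ℕ → ℕ → Set
Ancestor l x y = y < x × Σ (List ℕ) λ mid → (Segment l x mid y ⊎ Segment l y mid x) × All (_< x) mid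

PreservesAncestry : (ℕ → ℕ) → List ℕ → Set
PreservesAncestry f l = ∀ x y → Ancestor l x y → f y < f x

Segment-infix : ∀ {l a mid b} p s → Segment l a mid b → Segment (p ++ l ++ s) a mid b
Segment-infix {a = a} {mid} {b} p s (p₀ , s₀ , refl) = p ++ p₀ , s₀ ++ s , (begin
    p ++ (p₀ ++ a ∷ mid ++ b ∷ s₀) ++ s
  ≡⟨ cong (p ++_) (++-assoc p₀ (a ∷ mid ++ b ∷ s₀) s) ⟩
    p ++ p₀ ++ a ∷ (mid ++ b ∷ s₀) ++ s
  ≡⟨ cong (λ z → p ++ p₀ ++ a ∷ z) (++-assoc mid (b ∷ s₀) s) ⟩
    p ++ p₀ ++ a ∷ mid ++ b ∷ s₀ ++ s
  ≡⟨ ++-assoc p p₀ _ ⟨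
    (p ++ p₀) ++ a ∷ mid ++ b ∷ s₀ ++ s
  ∎)
  where open ≡-Reasoning

Ancestor-infix : ∀ {l x y} p s → Ancestor l x y → Ancestor (p ++ l ++ s) x y
Ancestor-infix p s (y<x , mid , inj₁ seg , mid<x) = y<x , mid , inj₁ (Segment-infix p s seg) , mid<x
Ancestor-infix p s (y<x , mid , inj₂ seg , mid<x) = y<x , mid , inj₂ (Segment-infix p s seg) , mid<x

PreservesAncestry-infix : ∀ {f L} p l s → L ≡ p ++ l ++ s → PreservesAncestry f L → PreservesAncestry f l
PreservesAncestry-infix p l s refl pres x y anc = pres x y (Ancestor-infix p s anc)

PreservesAncestry-∷ : ∀ {f x xs} → PreservesAncestry f (x ∷ xs) → PreservesAncestry f xs
PreservesAncestry-∷ {x = x} {xs} = PreservesAncestry-infix [ x ] xs [] (cong (x ∷_) (sym (++-identityʳ xs)))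

module _ {f α m β} (pres : PreservesAncestry f (α ++ m ∷ β)) where

  PreservesAncestry-++-∷ˡ : PreservesAncestry f α
  PreservesAncestry-++-∷ˡ = PreservesAncestry-infix [] α (m ∷ β) refl pres

  PreservesAncestry-++-∷ʳ : PreservesAncestry f β
  PreservesAncestry-++-∷ʳ = PreservesAncestry-infix (α ++ [ m ]) β [] eq pres
    where eq = trans (sym (++-assoc α [ m ] β)) (cong ((α ++ [ m ]) ++_) (sym (++-identityʳ β)))

Segment-reverse : ∀ {l a mid b} → Segment l a mid b → Segment (reverse l) b (reverse mid) a
Segment-reverse {a = a} {mid} {b} (p , s , refl) = reverse s , reverse p , (begin
    reverse (p ++ a ∷ mid ++ b ∷ s)
  ≡⟨ reverse-++-∷ p a (mid ++ b ∷ s) ⟩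
    reverse (mid ++ b ∷ s) ++ a ∷ reverse p
  ≡⟨ cong (_++ a ∷ reverse p) (reverse-++-∷ mid b s) ⟩
    (reverse s ++ b ∷ reverse mid) ++ a ∷ reverse p
  ≡⟨ ++-assoc (reverse s) (b ∷ reverse mid) _ ⟩
    reverse s ++ b ∷ reverse mid ++ a ∷ reverse p
  ∎)
  where open ≡-Reasoning

All-reverse : ∀ {P : ℕ → Set} {l} → All P l → All P (reverse l)
All-reverse {l = l} = ↭.All-resp-↭ (↭-sym (↭.↭-reverse l))

Ancestor-reverse : ∀ {l x y} → Ancestor l x y → Ancestor (reverse l) x y
Ancestor-reverse (y<x , mid , inj₁ seg , mid<x) = y<x , reverse mid , inj₂ (Segment-reverse seg) , All-reverse mid<x
Ancestor-reverse (y<x , mid , inj₂ seg , mid<x) = y<x , reverse mid , inj₁ (Segment-reverse seg) , All-reverse mid<x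

PreservesAncestry-reverse⁻ : ∀ {f l} → PreservesAncestry f (reverse l) → PreservesAncestry f l
PreservesAncestry-reverse⁻ pres x y anc = pres x y (Ancestor-reverse anc)

Ancestor-∈ : ∀ {l x y} → Ancestor l x y → x ∈ l × y ∈ l
Ancestor-∈ (_ , mid , inj₁ (p , s , refl) , _) = ∈-++⁺ʳ p (here refl) , ∈-++⁺ʳ p (there (∈-++⁺ʳ mid (here refl)))
Ancestor-∈ (_ , mid , inj₂ (p , s , refl) , _) = ∈-++⁺ʳ p (there (∈-++⁺ʳ mid (here refl))) , ∈-++⁺ʳ p (here refl)

Ancestor-maxˡ : ∀ {m α y} β → All (_< m) α → y ∈ α → Ancestor (α ++ m ∷ β) m y
Ancestor-maxˡ {m} β α<m y∈ with p , mid , refl ← ∈-∃++ y∈ =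
  All.lookup α<m y∈ , mid , inj₂ (p , β , ++-assoc p (_ ∷ mid) (m ∷ β)) ,
  All.++⁻ʳ (p ++ [ _ ]) (subst (All (_< m)) (sym (++-assoc p [ _ ] mid)) α<m)

Ancestor-maxʳ : ∀ {m β y} α → All (_< m) β → y ∈ β → Ancestor (α ++ m ∷ β) m y
Ancestor-maxʳ α β<m y∈ with mid , s , refl ← ∈-∃++ y∈ =
  All.lookup β<m y∈ , mid , inj₁ (α , s , refl) , All.++⁻ˡ mid β<m

Ancestor-++-∷-cases : ∀ {m x y} α β → All (_< m) α → All (_< m) β → Ancestor (α ++ m ∷ β) x y →
  x ≡ m ⊎ Ancestor α x y ⊎ Ancestor β x y
Ancestor-++-∷-cases {m} {x} {y} α β α<m β<m (y<x , mid , inj₁ (p , s , eq) , mid<x)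
  with ++-∷-compare α m β p x (mid ++ y ∷ s) eq
... | inj₁ (e , refl , eqβ) = inj₂ (inj₂ (y<x , mid , inj₁ (e , s , eqβ) , mid<x))
... | inj₂ (inj₁ (_ , refl , _)) = inj₁ refl
... | inj₂ (inj₂ (e , refl , eq₂)) with ++-∷-compare mid y s e m β eq₂
...   | inj₁ (e′ , refl , _) = inj₂ (inj₁ (y<x , mid , inj₁ (p , e′ , refl) , mid<x))
...   | inj₂ (inj₁ (_ , refl , _)) = contradiction (All.lookup α<m (∈-++⁺ʳ p (here refl))) (<-asym y<x)
...   | inj₂ (inj₂ (e′ , refl , _)) =
        contradiction (All.lookup α<m (∈-++⁺ʳ p (here refl))) (<-asym (All.lookup mid<x (∈-++⁺ʳ e (here refl))))
Ancestor-++-∷-cases {m} {x} {y} α β α<m β<m (y<x , mid , inj₂ (p , s , eq) , mid<x)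
  with ++-∷-compare α m β p y (mid ++ x ∷ s) eq
... | inj₁ (e , refl , eqβ) = inj₂ (inj₂ (y<x , mid , inj₂ (e , s , eqβ) , mid<x))
... | inj₂ (inj₁ (_ , refl , refl)) = contradiction (All.lookup β<m (∈-++⁺ʳ mid (here refl))) (<-asym y<x)
... | inj₂ (inj₂ (e , refl , eq₂)) with ++-∷-compare mid x s e m β eq₂
...   | inj₁ (e′ , refl , _) = inj₂ (inj₁ (y<x , mid , inj₂ (p , e′ , refl) , mid<x))
...   | inj₂ (inj₁ (_ , refl , _)) = inj₁ refl
...   | inj₂ (inj₂ (e′ , refl , refl)) =
        contradiction (All.lookup β<m (∈-++⁺ʳ e′ (here refl))) (<-asym (All.lookup mid<x (∈-++⁺ʳ e (here refl))))

stackSort-↭ : ∀ {l} → DecTree l → stackSort l ↭ l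
stackSort-↭ leaf = ↭-refl
stackSort-↭ (node {α} {β} {m} α<m β<m tα tβ) =
  subst (_↭ α ++ m ∷ β) (sym (stackSort-++-∷ α β α<m β<m))
    (↭.++⁺ (stackSort-↭ tα) (↭-trans (↭-sym (↭.∷↭∷ʳ m (stackSort β))) (prep m (stackSort-↭ tβ))))

∈-stackSort⁻ : ∀ {l x} → DecTree l → x ∈ stackSort l → x ∈ l
∈-stackSort⁻ t = ↭.∈-resp-↭ (stackSort-↭ t)

∈-stackSort⁺ : ∀ {l x} → DecTree l → x ∈ l → x ∈ stackSort l
∈-stackSort⁺ t = ↭.∈-resp-↭ (↭-sym (stackSort-↭ t))

All-stackSort⁺ : ∀ {P : ℕ → Set} {l} → DecTree l → All P l → All P (stackSort l)
All-stackSort⁺ t = ↭.All-resp-↭ (↭-sym (stackSort-↭ t))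

Ancestor-stackSort : ∀ {l x y} → DecTree l → Ancestor l x y → Ancestor (stackSort l) x y
Ancestor-stackSort leaf anc with () ← proj₁ (Ancestor-∈ anc)
Ancestor-stackSort {x = x} {y} (node {α} {β} {m} α<m β<m tα tβ) anc
  rewrite stackSort-++-∷ α β α<m β<m with Ancestor-++-∷-cases α β α<m β<m anc
... | inj₁ refl = subst (λ z → Ancestor z x y) (++-assoc (stackSort α) (stackSort β) [ m ])
        (Ancestor-maxˡ [] (All.++⁺ (All-stackSort⁺ tα α<m) (All-stackSort⁺ tβ β<m)) y∈)
  where
  y∈ : y ∈ stackSort α ++ stackSort β
  y∈ with ∈-++⁻ α (proj₂ (Ancestor-∈ anc))
  ... | inj₁ y∈α = ∈-++⁺ˡ (∈-stackSort⁺ tα y∈α)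
  ... | inj₂ (here refl) = contradiction (proj₁ anc) (<-irrefl refl)
  ... | inj₂ (there y∈β) = ∈-++⁺ʳ (stackSort α) (∈-stackSort⁺ tβ y∈β)
... | inj₂ (inj₁ anc-α) = Ancestor-infix [] (stackSort β ++ [ m ]) (Ancestor-stackSort tα anc-α)
... | inj₂ (inj₂ anc-β) = Ancestor-infix (stackSort α) [ m ] (Ancestor-stackSort tβ anc-β)

PreservesAncestry-stackSort⁻ : ∀ {f l} → DecTree l → PreservesAncestry f (stackSort l) → PreservesAncestry f l
PreservesAncestry-stackSort⁻ t pres x y anc = pres x y (Ancestor-stackSort t anc)

StrictMonoOn⇒PreservesAncestry : ∀ {f l} → (∀ {x y} → x ∈ l → y ∈ l → y < x → f y < f x) →
  PreservesAncestry f l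
StrictMonoOn⇒PreservesAncestry mono _ _ anc = mono (proj₁ (Ancestor-∈ anc)) (proj₂ (Ancestor-∈ anc)) (proj₁ anc)

stackSort-map : ∀ {f l} → DecTree l → PreservesAncestry f l → stackSort (map f l) ≡ map f (stackSort l)
stackSort-map leaf _ = refl
stackSort-map {f} (node {α} {β} {m} α<m β<m tα tβ) pres = begin
    stackSort (map f (α ++ m ∷ β))
  ≡⟨ cong stackSort (map-++ f α (m ∷ β)) ⟩
    stackSort (map f α ++ f m ∷ map f β)
  ≡⟨ stackSort-++-∷ (map f α) (map f β) fα<fm fβ<fm ⟩
    stackSort (map f α) ++ stackSort (map f β) ++ [ f m ]
  ≡⟨ cong₂ (λ u v → u ++ v ++ [ f m ]) (stackSort-map tα (PreservesAncestry-++-∷ˡ pres))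
                                       (stackSort-map tβ (PreservesAncestry-++-∷ʳ pres)) ⟩
    map f (stackSort α) ++ map f (stackSort β) ++ map f [ m ]
  ≡⟨ cong (map f (stackSort α) ++_) (map-++ f (stackSort β) [ m ]) ⟨
    map f (stackSort α) ++ map f (stackSort β ++ [ m ])
  ≡⟨ map-++ f (stackSort α) _ ⟨
    map f (stackSort α ++ stackSort β ++ [ m ])
  ≡⟨ cong (map f) (stackSort-++-∷ α β α<m β<m) ⟨
    map f (stackSort (α ++ m ∷ β))
  ∎
  where
  open ≡-Reasoning
  fα<fm = All.map⁺ (All.tabulate λ y∈ → pres m _ (Ancestor-maxˡ β α<m y∈))
  fβ<fm = All.map⁺ (All.tabulate λ y∈ → pres m _ (Ancestor-maxʳ α β<m y∈))

op-↭ : ∀ o {l} → Distinct l → op o l ↭ l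
op-↭ S ds = stackSort-↭ (Distinct⇒DecTree ds)
op-↭ R {l} _ = ↭.↭-reverse l

apply-↭ : ∀ A {θ} → Distinct θ → apply A θ ↭ θ
apply-↭ [] _ = ↭-refl
apply-↭ (o ∷ A) ds = ↭-trans (op-↭ o (Distinct-resp-↭ (↭-sym (apply-↭ A ds)) ds)) (apply-↭ A ds)

Distinct-apply : ∀ A {θ} → Distinct θ → Distinct (apply A θ)
Distinct-apply A ds = Distinct-resp-↭ (↭-sym (apply-↭ A ds)) ds

op-map : ∀ o {f l} → Distinct l → PreservesAncestry f (op o l) →
  PreservesAncestry f l × op o (map f l) ≡ map f (op o l)
op-map S ds pres = pres′ , stackSort-map t pres′
  where
  t = Distinct⇒DecTree ds
  pres′ = PreservesAncestry-stackSort⁻ t pres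
op-map R {f} {l} _ pres = PreservesAncestry-reverse⁻ pres , sym (reverse-map f l)

apply-map : ∀ A {f θ} → Distinct θ → PreservesAncestry f (apply A θ) →
  PreservesAncestry f θ × apply A (map f θ) ≡ map f (apply A θ)
apply-map [] _ pres = pres , refl
apply-map (o ∷ A) ds pres with presθ , A-map ← apply-map A ds (proj₁ (op-map o (Distinct-apply A ds) pres)) =
  presθ , trans (cong (op o) A-map) (proj₂ (op-map o (Distinct-apply A ds) pres))

apply-++ : ∀ B C θ → apply (B ++ C) θ ≡ apply B (apply C θ)
apply-++ [] C θ = refl
apply-++ (o ∷ B) C θ = cong (op o) (apply-++ B C θ)

idPerm-suc : ∀ n → idPerm (suc n) ≡ idPerm n ++ [ suc n ]
idPerm-suc n = trans (cong (map suc) (sym (applyUpTo-∷ʳ (λ i → i) n))) (map-++ suc (upTo n) [ n ])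

length-idPerm : ∀ n → length (idPerm n) ≡ n
length-idPerm n = trans (length-map suc (upTo n)) (length-upTo n)

IsPerm-length : ∀ {n l} → IsPerm n l → length l ≡ n
IsPerm-length {n} p = trans (↭.↭-length p) (length-idPerm n)

idPerm-+ : ∀ a b → idPerm (a + b) ≡ idPerm a ++ map (λ y → y + a) (idPerm b)
idPerm-+ a zero = trans (cong idPerm (+-identityʳ a)) (sym (++-identityʳ _))
idPerm-+ a (suc b) = begin
    idPerm (a + suc b)
  ≡⟨ cong idPerm (+-suc a b) ⟩
    idPerm (suc (a + b))
  ≡⟨ idPerm-suc (a + b) ⟩
    idPerm (a + b) ++ [ suc (a + b) ]
  ≡⟨ cong (_++ [ suc (a + b) ]) (idPerm-+ a b) ⟩
    (idPerm a ++ map (λ y → y + a) (idPerm b)) ++ [ suc (a + b) ]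
  ≡⟨ ++-assoc (idPerm a) _ _ ⟩
    idPerm a ++ map (λ y → y + a) (idPerm b) ++ [ suc (a + b) ]
  ≡⟨ cong (λ z → idPerm a ++ map (λ y → y + a) (idPerm b) ++ [ suc z ]) (+-comm a b) ⟩
    idPerm a ++ map (λ y → y + a) (idPerm b) ++ map (λ y → y + a) [ suc b ]
  ≡⟨ cong (idPerm a ++_) (map-++ (λ y → y + a) (idPerm b) [ suc b ]) ⟨
    idPerm a ++ map (λ y → y + a) (idPerm b ++ [ suc b ])
  ≡⟨ cong (λ z → idPerm a ++ map (λ y → y + a) z) (idPerm-suc b) ⟨
    idPerm a ++ map (λ y → y + a) (idPerm (suc b))
  ∎
  where open ≡-Reasoning

idPerm-++-∷ : ∀ a b → idPerm (suc (a + b)) ≡ idPerm a ++ map (λ y → y + a) (idPerm b) ++ [ suc (a + b) ]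
idPerm-++-∷ a b =
  trans (idPerm-suc (a + b)) (trans (cong (_++ [ suc (a + b) ]) (idPerm-+ a b)) (++-assoc (idPerm a) _ _))

idPerm-as-blocks : ∀ α β {m} → m ≡ suc (length α + length β) →
  idPerm (length β) ++ map (λ y → y + length β) (idPerm (length α)) ++ [ m ] ≡ idPerm (length (α ++ m ∷ β))
idPerm-as-blocks α β {m} m≡ = trans (cong (λ z → idPerm b ++ map (λ y → y + b) (idPerm a) ++ [ z ]) m≡′)
  (trans (sym (idPerm-++-∷ b a)) (cong idPerm (sym (trans (length-++-∷ α m β) (cong suc (+-comm a b))))))
  where
  a = length α
  b = length β
  m≡′ = trans m≡ (cong suc (+-comm a b))

∈-idPerm⁻ : ∀ {z k} → z ∈ idPerm k → 1 ≤ z × z ≤ k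
∈-idPerm⁻ z∈ with y , y∈ , refl ← ∈-map⁻ suc z∈ = s≤s z≤n , ∈-upTo⁻ y∈

∈-idPerm⁺ : ∀ {z k} → 1 ≤ z → z ≤ k → z ∈ idPerm k
∈-idPerm⁺ {suc z} (s≤s _) z≤k = ∈-map⁺ suc (∈-upTo⁺ z≤k)

∈-shifted-idPerm⁻ : ∀ {z c k} → z ∈ map (λ y → y + c) (idPerm k) → c < z × z ≤ k + c
∈-shifted-idPerm⁻ {c = c} z∈ with y , y∈ , refl ← ∈-map⁻ (λ y → y + c) z∈ =
  +-monoˡ-≤ c (proj₁ (∈-idPerm⁻ y∈)) , +-monoˡ-≤ c (proj₂ (∈-idPerm⁻ y∈))

map-∸-+ : ∀ c (l : List ℕ) → All (c <_) l → map (λ y → y + c) (map (λ z → z ∸ c) l) ≡ l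
map-∸-+ c [] [] = refl
map-∸-+ c (x ∷ l) (c<x ∷ c<l) = cong₂ _∷_ (m∸n+n≡m (<⇒≤ c<x)) (map-∸-+ c l c<l)

map-+-∸ : ∀ c (l : List ℕ) → map (λ z → z ∸ c) (map (λ y → y + c) l) ≡ l
map-+-∸ c [] = refl
map-+-∸ c (x ∷ l) = cong₂ _∷_ (m+n∸n≡m x c) (map-+-∸ c l)

DecTree-map : ∀ {f l} → (∀ {x y} → y < x → f y < f x) → DecTree l → DecTree (map f l)
DecTree-map mono leaf = leaf
DecTree-map {f} mono (node {α} {β} {m} α<m β<m tα tβ) =
  subst DecTree (sym (map-++ f α (m ∷ β)))
    (node (All.map⁺ (All.map mono α<m)) (All.map⁺ (All.map mono β<m)) (DecTree-map mono tα) (DecTree-map mono tβ))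

StackSortable : List ℕ → Set
StackSortable l = stackSort l ≡ idPerm (length l)

StackSortable⇒↭idPerm : ∀ {l} → DecTree l → StackSortable l → l ↭ idPerm (length l)
StackSortable⇒↭idPerm {l} t sortable = ↭-trans (↭-sym (stackSort-↭ t)) (subst (stackSort l ↭_) sortable ↭-refl)

StackSortable-++-∷ : ∀ {m} α β → All (_< m) α → All (_< m) β → DecTree α → StackSortable (α ++ m ∷ β) →
  m ≡ suc (length α + length β) × StackSortable α × stackSort β ≡ map (λ y → y + length α) (idPerm (length β))
StackSortable-++-∷ {m} α β α<m β<m tα sortable =
  m≡ , ++-injectiveˡ (stackSort α) (trans (↭.↭-length (stackSort-↭ tα)) (sym (length-idPerm a))) front≡
  where
  a = length α
  b = length β
  eq : (stackSort α ++ stackSort β) ++ [ m ] ≡ (idPerm a ++ map (λ y → y + a) (idPerm b)) ++ [ suc (a + b) ]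
  eq = begin
      (stackSort α ++ stackSort β) ++ [ m ]
    ≡⟨ ++-assoc (stackSort α) _ _ ⟩
      stackSort α ++ stackSort β ++ [ m ]
    ≡⟨ stackSort-++-∷ α β α<m β<m ⟨
      stackSort (α ++ m ∷ β)
    ≡⟨ trans sortable (cong idPerm (length-++-∷ α m β)) ⟩
      idPerm (suc (a + b))
    ≡⟨ trans (idPerm-suc (a + b)) (cong (_++ [ suc (a + b) ]) (idPerm-+ a b)) ⟩
      (idPerm a ++ map (λ y → y + a) (idPerm b)) ++ [ suc (a + b) ]
    ∎
    where open ≡-Reasoning
  front≡ = proj₁ (∷ʳ-injective _ _ eq)
  m≡ = proj₂ (∷ʳ-injective _ _ eq)

-- With β′ := β lowered by |α|, a sortable α ++ m ∷ β is α ⊕ (1 ⊖ β′).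
record SortableNode (α β : List ℕ) (m : ℕ) : Set where
  field
    max≡ : m ≡ suc (length α + length β)
    sortableˡ : StackSortable α
    distinctˡ : Distinct α
    right> : All (length α <_) β
    distinct′ : Distinct (map (λ z → z ∸ length α) β)
    sortable′ : StackSortable (map (λ z → z ∸ length α) β)

sortableNode : ∀ {α β m} → All (_< m) α → All (_< m) β → DecTree α → DecTree β →
  Distinct (α ++ m ∷ β) → StackSortable (α ++ m ∷ β) → SortableNode α β m
sortableNode {α} {β} {m} α<m β<m tα tβ ds sortable = record
  { max≡ = max≡ ; sortableˡ = sortableˡ ; distinctˡ = proj₁ (Distinct-++-∷⁻ α ds) ; right> = right>
  ; distinct′ = Distinct-map⁻ (λ y → y + a) (subst Distinct (sym (map-∸-+ a β right>)) (proj₂ (Distinct-++-∷⁻ α ds)))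
  ; sortable′ = sortable′ }
  where
  a = length α
  b = length β
  parts = StackSortable-++-∷ α β α<m β<m tα sortable
  max≡ = proj₁ parts
  sortableˡ = proj₁ (proj₂ parts)
  sortβ = proj₂ (proj₂ parts)
  right> : All (a <_) β
  right> = All.tabulate λ y∈ → proj₁ (∈-shifted-idPerm⁻ (subst (_ ∈_) sortβ (∈-stackSort⁺ tβ y∈)))
  sortable′ : StackSortable (map (λ z → z ∸ a) β)
  sortable′ = begin
      stackSort (map (λ z → z ∸ a) β)
    ≡⟨ stackSort-map tβ (StrictMonoOn⇒PreservesAncestry λ _ y∈ y<x → ∸-monoˡ-< y<x (<⇒≤ (All.lookup right> y∈))) ⟩
      map (λ z → z ∸ a) (stackSort β)
    ≡⟨ cong (map (λ z → z ∸ a)) sortβ ⟩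
      map (λ z → z ∸ a) (map (λ y → y + a) (idPerm b))
    ≡⟨ map-+-∸ a (idPerm b) ⟩
      idPerm b
    ≡⟨ cong idPerm (length-map _ β) ⟨
      idPerm (length (map (λ z → z ∸ a) β))
    ∎
    where open ≡-Reasoning

-- The bijection P

↭-++-∷-rotate : ∀ (X : List ℕ) m Y → X ++ m ∷ Y ↭ Y ++ X ++ [ m ]
↭-++-∷-rotate X m Y =
  ↭-trans (↭.shift m X Y) (↭-trans (prep m (↭.++-comm X Y))
    (subst (m ∷ Y ++ X ↭_) (++-assoc Y X [ m ]) (↭.∷↭∷ʳ m (Y ++ X))))

P-↭idPerm : ∀ {π} → Distinct π → StackSortable π → P π ↭ idPerm (length π)
P-↭idPerm {π} = go (length π) π ≤-refl
  where
  go : ∀ k π → length π ≤ k → Distinct π → StackSortable π → P π ↭ idPerm (length π)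
  go k π len ds sortable with Distinct⇒DecTree ds
  ... | leaf = ↭-refl
  go zero _ len ds sortable | node {α} {β} {m} _ _ _ _ = contradiction len (length-++-∷≰0 α)
  go (suc k) _ len ds sortable | node {α} {β} {m} α<m β<m tα tβ = begin
      P (α ++ m ∷ β)
    ≡⟨ P-++-∷ α β α<m β<m ⟩
      map (λ y → y + b) (P α) ++ m ∷ P β′
    ↭⟨ ↭.++⁺ (↭.map⁺ _ (go k α (length-left≤ α len) distinctˡ sortableˡ))
             (prep m (subst (λ z → P β′ ↭ idPerm z) (length-map _ β) (go k β′ (length-map-right≤ α len _) distinct′ sortable′))) ⟩
      map (λ y → y + b) (idPerm a) ++ m ∷ idPerm b
    ↭⟨ ↭-++-∷-rotate _ m (idPerm b) ⟩
      idPerm b ++ map (λ y → y + b) (idPerm a) ++ [ m ]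
    ≡⟨ idPerm-as-blocks α β max≡ ⟩
      idPerm (length (α ++ m ∷ β))
    ∎
    where
    open Perm.PermutationReasoning
    open SortableNode (sortableNode α<m β<m tα tβ ds sortable)
    a = length α
    b = length β
    β′ = map (λ z → z ∸ a) β

Distinct-P : ∀ {π} → Distinct π → StackSortable π → Distinct (P π)
Distinct-P ds sortable = Distinct-resp-↭ (↭-sym (P-↭idPerm ds sortable)) (Distinct-idPerm _)

∈-P⁻ : ∀ {π z} → Distinct π → StackSortable π → z ∈ P π → 1 ≤ z × z ≤ length π
∈-P⁻ ds sortable z∈ = ∈-idPerm⁻ (↭.∈-resp-↭ (P-↭idPerm ds sortable) z∈)

P-node-bounds : ∀ {α β m} → SortableNode α β m →
  All (_< m) (map (λ y → y + length β) (P α)) × All (_< m) (P (map (λ z → z ∸ length α) β))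
P-node-bounds {α} {β} {m} nd = All.map⁺ (All.tabulate left<) , All.tabulate right<
  where
  open SortableNode nd
  a = length α
  b = length β
  left< : ∀ {y} → y ∈ P α → y + b < m
  left< y∈ = subst (_ + b <_) (sym max≡) (s≤s (+-monoˡ-≤ b (proj₂ (∈-P⁻ distinctˡ sortableˡ y∈))))
  right< : ∀ {y} → y ∈ P (map (λ z → z ∸ a) β) → y < m
  right< y∈ = subst (_ <_) (sym max≡)
    (s≤s (≤-trans (proj₂ (∈-P⁻ distinct′ sortable′ y∈)) (≤-trans (≤-reflexive (length-map _ β)) (m≤n+m b a))))

length-reverse-P : ∀ l → length (reverse (P l)) ≡ length l
length-reverse-P l = trans (length-reverse (P l)) (length-P l)

StackSortable-reverse-shift : ∀ c {l} → Distinct l → StackSortable (reverse l) →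
  stackSort (reverse (map (λ y → y + c) l)) ≡ map (λ y → y + c) (idPerm (length l))
StackSortable-reverse-shift c {l} ds sortable = begin
    stackSort (reverse (map (λ y → y + c) l))
  ≡⟨ cong stackSort (reverse-map _ l) ⟨
    stackSort (map (λ y → y + c) (reverse l))
  ≡⟨ stackSort-map (Distinct⇒DecTree (Distinct-reverse ds)) (StrictMonoOn⇒PreservesAncestry λ _ _ → +-monoˡ-< c) ⟩
    map (λ y → y + c) (stackSort (reverse l))
  ≡⟨ cong (map (λ y → y + c)) (trans sortable (cong idPerm (length-reverse l))) ⟩
    map (λ y → y + c) (idPerm (length l))
  ∎
  where open ≡-Reasoning

StackSortable-reverse-P : ∀ {π} → Distinct π → StackSortable π → StackSortable (reverse (P π))
StackSortable-reverse-P {π} = go (length π) π ≤-refl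
  where
  go : ∀ k π → length π ≤ k → Distinct π → StackSortable π → StackSortable (reverse (P π))
  go k π len ds sortable with Distinct⇒DecTree ds
  ... | leaf = refl
  go zero _ len ds sortable | node {α} {β} {m} _ _ _ _ = contradiction len (length-++-∷≰0 α)
  go (suc k) _ len ds sortable | node {α} {β} {m} α<m β<m tα tβ = begin
      stackSort (reverse (P (α ++ m ∷ β)))
    ≡⟨ cong (stackSort ∘ reverse) (P-++-∷ α β α<m β<m) ⟩
      stackSort (reverse (map (λ y → y + b) (P α) ++ m ∷ P β′))
    ≡⟨ cong stackSort (reverse-++-∷ (map (λ y → y + b) (P α)) m (P β′)) ⟩
      stackSort (reverse (P β′) ++ m ∷ reverse (map (λ y → y + b) (P α)))
    ≡⟨ stackSort-++-∷ _ _ (All-reverse (proj₂ bounds)) (All-reverse (proj₁ bounds)) ⟩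
      stackSort (reverse (P β′)) ++ stackSort (reverse (map (λ y → y + b) (P α))) ++ [ m ]
    ≡⟨ cong₂ (λ u v → u ++ v ++ [ m ]) sortedʳ sortedˡ ⟩
      idPerm b ++ map (λ y → y + b) (idPerm a) ++ [ m ]
    ≡⟨ idPerm-as-blocks α β max≡ ⟩
      idPerm (length (α ++ m ∷ β))
    ≡⟨ cong idPerm (length-reverse-P (α ++ m ∷ β)) ⟨
      idPerm (length (reverse (P (α ++ m ∷ β))))
    ∎
    where
    open ≡-Reasoning
    nd = sortableNode α<m β<m tα tβ ds sortable
    open SortableNode nd
    a = length α
    b = length β
    β′ = map (λ z → z ∸ a) β
    bounds = P-node-bounds nd
    sortedʳ : stackSort (reverse (P β′)) ≡ idPerm b
    sortedʳ = trans (go k β′ (length-map-right≤ α len _) distinct′ sortable′)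
                    (cong idPerm (trans (length-reverse-P β′) (length-map _ β)))
    sortedˡ : stackSort (reverse (map (λ y → y + b) (P α))) ≡ map (λ y → y + b) (idPerm a)
    sortedˡ = trans (StackSortable-reverse-shift b (Distinct-P distinctˡ sortableˡ) (go k α (length-left≤ α len) distinctˡ sortableˡ))
                    (cong (λ z → map (λ y → y + b) (idPerm z)) (length-P α))

data SameShape : List ℕ → List ℕ → Set where
  leaf : SameShape [] []
  node : ∀ {α β m α′ β′ m′} → All (_< m) α → All (_< m) β → All (_< m′) α′ → All (_< m′) β′ →
         length α ≡ length α′ → SameShape α α′ → SameShape β β′ → SameShape (α ++ m ∷ β) (α′ ++ m′ ∷ β′)

SameShape-sym : ∀ {l q} → SameShape l q → SameShape q l
SameShape-sym leaf = leaf
SameShape-sym (node α<m β<m α′<m′ β′<m′ len sα sβ) =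
  node α′<m′ β′<m′ α<m β<m (sym len) (SameShape-sym sα) (SameShape-sym sβ)

SameShape-mapʳ : ∀ {h l q} → (∀ {x y} → y < x → h y < h x) → SameShape l q → SameShape l (map h q)
SameShape-mapʳ mono leaf = leaf
SameShape-mapʳ {h} mono (node {α′ = α′} {β′} {m′} α<m β<m α′<m′ β′<m′ len sα sβ) =
  subst (SameShape _) (sym (map-++ h α′ (m′ ∷ β′)))
    (node α<m β<m (All.map⁺ (All.map mono α′<m′)) (All.map⁺ (All.map mono β′<m′))
      (trans len (sym (length-map h α′))) (SameShape-mapʳ mono sα) (SameShape-mapʳ mono sβ))

SameShape-mapˡ : ∀ {h l q} → (∀ {x y} → y < x → h y < h x) → SameShape l q → SameShape (map h l) q
SameShape-mapˡ mono = SameShape-sym ∘ SameShape-mapʳ mono ∘ SameShape-sym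

SameShape-map⇒PreservesAncestry : ∀ {f l q} → SameShape l q → map f l ≡ q → PreservesAncestry f l
SameShape-map⇒PreservesAncestry leaf _ _ _ anc with () ← proj₁ (Ancestor-∈ anc)
SameShape-map⇒PreservesAncestry {f} (node {α} {β} {m} {α′} {β′} {m′} α<m β<m α′<m′ β′<m′ len sα sβ) eq x y anc
  with fα≡ , fm≡ , fβ≡ ← ++-∷-injective (map f α) (trans (length-map f α) len) (trans (sym (map-++ f α (m ∷ β))) eq)
  with Ancestor-++-∷-cases α β α<m β<m anc
... | inj₁ refl = subst (f y <_) (sym fm≡) fy<m′
  where
  fy<m′ : f y < m′
  fy<m′ with ∈-++⁻ α (proj₂ (Ancestor-∈ anc))
  ... | inj₁ y∈α = All.lookup α′<m′ (subst (f y ∈_) fα≡ (∈-map⁺ f y∈α))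
  ... | inj₂ (here refl) = contradiction (proj₁ anc) (<-irrefl refl)
  ... | inj₂ (there y∈β) = All.lookup β′<m′ (subst (f y ∈_) fβ≡ (∈-map⁺ f y∈β))
... | inj₂ (inj₁ anc-α) = SameShape-map⇒PreservesAncestry sα fα≡ x y anc-α
... | inj₂ (inj₂ anc-β) = SameShape-map⇒PreservesAncestry sβ fβ≡ x y anc-β

SameShape-P : ∀ {π} → Distinct π → StackSortable π → SameShape π (P π)
SameShape-P {π} = go (length π) π ≤-refl
  where
  go : ∀ k π → length π ≤ k → Distinct π → StackSortable π → SameShape π (P π)
  go k π len ds sortable with Distinct⇒DecTree ds
  ... | leaf = leaf
  go zero _ len ds sortable | node {α} {β} {m} _ _ _ _ = contradiction len (length-++-∷≰0 α)
  go (suc k) _ len ds sortable | node {α} {β} {m} α<m β<m tα tβ =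
    subst (SameShape (α ++ m ∷ β)) (sym (P-++-∷ α β α<m β<m))
      (node α<m β<m (proj₁ bounds) (proj₂ bounds) (sym (trans (length-map _ (P α)) (length-P α))) sα sβ)
    where
    nd = sortableNode α<m β<m tα tβ ds sortable
    open SortableNode nd
    a = length α
    b = length β
    bounds = P-node-bounds nd
    sα = SameShape-mapʳ (+-monoˡ-< b) (go k α (length-left≤ α len) distinctˡ sortableˡ)
    β′ = map (λ z → z ∸ a) β
    sβ = subst (λ z → SameShape z (P β′)) (map-∸-+ a β right>)
           (SameShape-mapˡ (+-monoˡ-< a) (go k β′ (length-map-right≤ α len _) distinct′ sortable′))

P-++-∷-injective : ∀ {α β m γ δ m′} → All (_< m) α → All (_< m) β → All (_< m′) γ → All (_< m′) δ →
  SortableNode α β m → SortableNode γ δ m′ → Distinct (P (α ++ m ∷ β)) → P (α ++ m ∷ β) ≡ P (γ ++ m′ ∷ δ) →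
  m ≡ m′ × length α ≡ length γ × P α ≡ P γ × P (map (λ z → z ∸ length α) β) ≡ P (map (λ z → z ∸ length γ) δ)
P-++-∷-injective {α} {β} {m} {γ} {δ} {m′} α<m β<m γ<m′ δ<m′ N N′ ds eq =
  m≡m′ , a≡c , map-injective (+-cancelʳ-≡ b _ _) (trans (proj₁ halves) (cong (λ z → map (λ y → y + z) (P γ)) (sym b≡e))) ,
  proj₂ halves
  where
  module N = SortableNode N
  module N′ = SortableNode N′
  a = length α
  b = length β
  c = length γ
  e = length δ
  len≡ : suc (a + b) ≡ suc (c + e)
  len≡ = trans (sym (length-++-∷ α m β)) (trans (sym (length-P (α ++ m ∷ β)))
           (trans (cong length eq) (trans (length-P (γ ++ m′ ∷ δ)) (length-++-∷ γ m′ δ))))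
  m≡m′ : m ≡ m′
  m≡m′ = trans N.max≡ (trans len≡ (sym N′.max≡))
  δ′ = map (λ z → z ∸ c) δ
  eq′ : map (λ y → y + b) (P α) ++ m ∷ P (map (λ z → z ∸ a) β) ≡ map (λ y → y + e) (P γ) ++ m ∷ P δ′
  eq′ = trans (sym (P-++-∷ α β α<m β<m))
          (trans eq (trans (P-++-∷ γ δ γ<m′ δ<m′) (cong (λ z → map (λ y → y + e) (P γ) ++ z ∷ P δ′) (sym m≡m′))))
  halves = Distinct-split-unique _ m _ _ _ (subst Distinct (P-++-∷ α β α<m β<m) ds) refl eq′
  a≡c : a ≡ c
  a≡c = trans (sym (trans (length-map _ (P α)) (length-P α)))
          (trans (cong length (proj₁ halves)) (trans (length-map _ (P γ)) (length-P γ)))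
  b≡e : b ≡ e
  b≡e = +-cancelˡ-≡ a b e (trans (suc-injective len≡) (cong (_+ e) (sym a≡c)))

P-injective : ∀ {π π′} → Distinct π → StackSortable π → Distinct π′ → StackSortable π′ → P π ≡ P π′ → π ≡ π′
P-injective {π} {π′} = go (length π) π π′ ≤-refl
  where
  go : ∀ k π π′ → length π ≤ k → Distinct π → StackSortable π → Distinct π′ → StackSortable π′ →
       P π ≡ P π′ → π ≡ π′
  go k π π′ len ds s ds′ s′ eq with Distinct⇒DecTree ds | Distinct⇒DecTree ds′
  ... | leaf | leaf = refl
  ... | leaf | node {γ} {δ} {m′} _ _ _ _ =
    contradiction (trans (cong length eq) (trans (length-P (γ ++ m′ ∷ δ)) (length-++-∷ γ m′ δ))) 0≢1+n
  ... | node {α} {β} {m} _ _ _ _ | leaf =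
    contradiction (trans (cong length (sym eq)) (trans (length-P (α ++ m ∷ β)) (length-++-∷ α m β))) 0≢1+n
  go zero _ _ len _ _ _ _ _ | node {α} _ _ _ _ | node _ _ _ _ = contradiction len (length-++-∷≰0 α)
  go (suc k) _ _ len ds s ds′ s′ eq | node {α} {β} {m} α<m β<m tα tβ | node {γ} {δ} γ<m′ δ<m′ tγ tδ
    with refl , a≡c , Pα≡Pγ , Pβ′≡Pδ′ ← P-++-∷-injective α<m β<m γ<m′ δ<m′
           (sortableNode α<m β<m tα tβ ds s) (sortableNode γ<m′ δ<m′ tγ tδ ds′ s′) (Distinct-P ds s) eq
    = cong₂ (λ u v → u ++ m ∷ v) α≡γ β≡δ
    where
    module N = SortableNode (sortableNode α<m β<m tα tβ ds s)
    module N′ = SortableNode (sortableNode γ<m′ δ<m′ tγ tδ ds′ s′)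
    α≡γ : α ≡ γ
    α≡γ = go k α γ (length-left≤ α len) N.distinctˡ N.sortableˡ N′.distinctˡ N′.sortableˡ Pα≡Pγ
    β≡δ : β ≡ δ
    β≡δ = trans (sym (map-∸-+ (length α) β N.right>))
            (trans (cong₂ (λ u v → map (λ y → y + u) v) a≡c
                     (go k _ _ (length-map-right≤ α len _) N.distinct′ N.sortable′ N′.distinct′ N′.sortable′ Pβ′≡Pδ′))
                   (map-∸-+ (length γ) δ N′.right>))
∈-StackSortable⁻ : ∀ {l y} → Distinct l → StackSortable l → y ∈ l → 1 ≤ y × y ≤ length l
∈-StackSortable⁻ ds sortable y∈ = ∈-idPerm⁻ (↭.∈-resp-↭ (StackSortable⇒↭idPerm (Distinct⇒DecTree ds) sortable) y∈)

_⊕1⊖_ : List ℕ → List ℕ → List ℕ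
α ⊕1⊖ β = α ++ suc (length α + length β) ∷ map (λ y → y + length α) β

module _ {α β} (dα : Distinct α) (sα : StackSortable α) (dβ : Distinct β) (sβ : StackSortable β) where

  private
    a = length α
    b = length β
    m = suc (a + b)
    β⁺ = map (λ y → y + a) β
    α<m : All (_< m) α
    α<m = All.tabulate λ y∈ → s≤s (≤-trans (proj₂ (∈-StackSortable⁻ dα sα y∈)) (m≤m+n a b))
    β⁺<m : All (_< m) β⁺
    β⁺<m = All.map⁺ (All.tabulate λ y∈ →
      s≤s (≤-trans (+-monoˡ-≤ a (proj₂ (∈-StackSortable⁻ dβ sβ y∈))) (≤-reflexive (+-comm b a))))
    tβ = Distinct⇒DecTree dβ
    t : DecTree (α ⊕1⊖ β)
    t = node α<m β⁺<m (Distinct⇒DecTree dα) (DecTree-map (+-monoˡ-< a) tβ)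

  StackSortable-⊕1⊖ : StackSortable (α ⊕1⊖ β)
  StackSortable-⊕1⊖ = begin
      stackSort (α ++ m ∷ β⁺)
    ≡⟨ stackSort-++-∷ α β⁺ α<m β⁺<m ⟩
      stackSort α ++ stackSort β⁺ ++ [ m ]
    ≡⟨ cong (λ z → stackSort α ++ z ++ [ m ]) (stackSort-map tβ (StrictMonoOn⇒PreservesAncestry λ _ _ → +-monoˡ-< a)) ⟩
      stackSort α ++ map (λ y → y + a) (stackSort β) ++ [ m ]
    ≡⟨ cong₂ (λ u v → u ++ map (λ y → y + a) v ++ [ m ]) sα sβ ⟩
      idPerm a ++ map (λ y → y + a) (idPerm b) ++ [ m ]
    ≡⟨ idPerm-++-∷ a b ⟨
      idPerm m
    ≡⟨ cong idPerm (trans (length-++-∷ α m β⁺) (cong (λ z → suc (a + z)) (length-map _ β))) ⟨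
      idPerm (length (α ⊕1⊖ β))
    ∎
    where open ≡-Reasoning

  Distinct-⊕1⊖ : Distinct (α ⊕1⊖ β)
  Distinct-⊕1⊖ = Distinct-resp-↭ (↭-sym (StackSortable⇒↭idPerm t StackSortable-⊕1⊖)) (Distinct-idPerm _)

  P-⊕1⊖ : P (α ⊕1⊖ β) ≡ map (λ y → y + b) (P α) ++ m ∷ P β
  P-⊕1⊖ = trans (P-++-∷ α β⁺ α<m β⁺<m)
            (cong₂ (λ u v → map (λ y → y + u) (P α) ++ m ∷ P v) (length-map _ β) (map-+-∸ a β))

-- With γ′ := γ lowered by |δ|, a list γ ++ m ∷ δ with sortable reverse is (γ′ ⊕ 1) ⊖ δ.
record ReverseSortableNode (γ δ : List ℕ) (m : ℕ) : Set where
  field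
    max≡ : m ≡ suc (length γ + length δ)
    distinctʳ : Distinct δ
    reverse-sortableʳ : StackSortable (reverse δ)
    left> : All (length δ <_) γ
    distinct′ : Distinct (map (λ z → z ∸ length δ) γ)
    reverse-sortable′ : StackSortable (reverse (map (λ z → z ∸ length δ) γ))

reverseSortableNode : ∀ {γ δ m} → All (_< m) γ → All (_< m) δ → Distinct (γ ++ m ∷ δ) →
  StackSortable (reverse (γ ++ m ∷ δ)) → ReverseSortableNode γ δ m
reverseSortableNode {γ} {δ} {m} γ<m δ<m ds sortable = record
  { max≡ = trans max≡ (trans (cong₂ (λ u v → suc (u + v)) (length-reverse δ) (length-reverse γ)) (cong suc (+-comm b (length γ))))
  ; distinctʳ = dsδ
  ; reverse-sortableʳ = sortableˡ
  ; left> = γ>b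
  ; distinct′ = Distinct-map⁻ (λ y → y + b) (subst Distinct (sym (map-∸-+ b γ γ>b)) dsγ)
  ; reverse-sortable′ = subst StackSortable (reverse-map _ γ)
      (subst (λ c → StackSortable (map (λ z → z ∸ c) (reverse γ))) (length-reverse δ) sortable′) }
  where
  dsγ = proj₁ (Distinct-++-∷⁻ γ ds)
  dsδ = proj₂ (Distinct-++-∷⁻ γ ds)
  b = length δ
  open SortableNode (sortableNode (All-reverse δ<m) (All-reverse γ<m)
    (Distinct⇒DecTree (Distinct-reverse dsδ)) (Distinct⇒DecTree (Distinct-reverse dsγ))
    (subst Distinct (reverse-++-∷ γ m δ) (Distinct-reverse ds)) (subst StackSortable (reverse-++-∷ γ m δ) sortable))
  γ>b : All (b <_) γ
  γ>b = subst (λ z → All (z <_) γ) (length-reverse δ) (subst (All _) (reverse-involutive γ) (All-reverse right>))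

P-Preimage : List ℕ → Set
P-Preimage κ = Σ (List ℕ) λ π → Distinct π × StackSortable π × P π ≡ κ

P-Preimage-++-∷ : ∀ {γ δ m} → ReverseSortableNode γ δ m →
  P-Preimage (map (λ z → z ∸ length δ) γ) → P-Preimage δ → P-Preimage (γ ++ m ∷ δ)
P-Preimage-++-∷ {γ} {δ} {m} N (π₁ , d₁ , s₁ , P₁≡) (π₂ , d₂ , s₂ , P₂≡) =
  π₁ ⊕1⊖ π₂ , Distinct-⊕1⊖ d₁ s₁ d₂ s₂ , StackSortable-⊕1⊖ d₁ s₁ d₂ s₂ , (begin
      P (π₁ ⊕1⊖ π₂)
    ≡⟨ P-⊕1⊖ d₁ s₁ d₂ s₂ ⟩
      map (λ y → y + length π₂) (P π₁) ++ suc (length π₁ + length π₂) ∷ P π₂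
    ≡⟨ cong₂ (λ u v → map (λ y → y + u) (P π₁) ++ v ∷ P π₂) |π₂|≡ m≡ ⟩
      map (λ y → y + b) (P π₁) ++ m ∷ P π₂
    ≡⟨ cong₂ (λ u v → map (λ y → y + b) u ++ m ∷ v) P₁≡ P₂≡ ⟩
      map (λ y → y + b) (map (λ z → z ∸ b) γ) ++ m ∷ δ
    ≡⟨ cong (_++ m ∷ δ) (map-∸-+ b γ left>) ⟩
      γ ++ m ∷ δ
    ∎)
  where
  open ≡-Reasoning
  open ReverseSortableNode N
  b = length δ
  |π₁|≡ : length π₁ ≡ length γ
  |π₁|≡ = trans (sym (length-P π₁)) (trans (cong length P₁≡) (length-map _ γ))
  |π₂|≡ : length π₂ ≡ b
  |π₂|≡ = trans (sym (length-P π₂)) (cong length P₂≡)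
  m≡ : suc (length π₁ + length π₂) ≡ m
  m≡ = trans (cong₂ (λ u v → suc (u + v)) |π₁|≡ |π₂|≡) (sym max≡)

P-surjective : ∀ {κ} → Distinct κ → StackSortable (reverse κ) → P-Preimage κ
P-surjective {κ} = go (length κ) κ ≤-refl
  where
  go : ∀ k κ → length κ ≤ k → Distinct κ → StackSortable (reverse κ) → P-Preimage κ
  go k κ len ds sortable with Distinct⇒DecTree ds
  ... | leaf = [] , [] , refl , refl
  go zero _ len ds sortable | node {γ} _ _ _ _ = contradiction len (length-++-∷≰0 γ)
  go (suc k) _ len ds sortable | node {γ} {δ} {m} γ<m δ<m _ _ =
    P-Preimage-++-∷ N (go k _ (≤-trans (≤-reflexive (length-map _ γ)) (length-left≤ γ len)) N.distinct′ N.reverse-sortable′)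
                      (go k δ (length-right≤ γ len) N.distinctʳ N.reverse-sortableʳ)
    where
    N = reverseSortableNode γ<m δ<m ds sortable
    module N = ReverseSortableNode N

map-id⁻ : ∀ {h : ℕ → ℕ} l → map h l ≡ l → ∀ {v} → v ∈ l → h v ≡ v
map-id⁻ (x ∷ l) eq (here refl) = ∷-injectiveˡ eq
map-id⁻ (x ∷ l) eq (there v∈) = map-id⁻ l (∷-injectiveʳ eq) v∈

map-at-indexOf : ∀ {l} q → Distinct l → length q ≡ length l → map (λ v → at q (indexOf v l)) l ≡ q
map-at-indexOf {[]} [] _ _ = refl
map-at-indexOf {x ∷ l} (y ∷ q) (x∉ ∷ ds) len = cong₂ _∷_ head≡
  (trans (map-cong-local (All.tabulate λ v∈ → cong (at (y ∷ q)) (indexOf-there v∈))) (map-at-indexOf q ds (suc-injective len)))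
  where
  head≡ : at (y ∷ q) (indexOf x (x ∷ l)) ≡ y
  head≡ rewrite ≡ᵇ-refl x = refl
  indexOf-there : ∀ {v} → v ∈ l → indexOf v (x ∷ l) ≡ suc (indexOf v l)
  indexOf-there {v} v∈ rewrite ≢⇒≡ᵇ-false x v (λ { refl → x∉ v∈ }) = refl

lamInv : List ℕ → ℕ → ℕ
lamInv π w = at π (indexOf w (P π))

map-lam : ∀ {π} → Distinct π → map (lam π) π ≡ P π
map-lam {π} ds = map-at-indexOf (P π) ds (length-P π)

map-lamInv : ∀ {π} → Distinct π → StackSortable π → map (lamInv π) (P π) ≡ π
map-lamInv {π} ds sortable = map-at-indexOf π (Distinct-P ds sortable) (sym (length-P π))

record InverseOn (n : ℕ) (f g : ℕ → ℕ) : Set where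
  field
    f∈ : ∀ {v} → v ∈ idPerm n → f v ∈ idPerm n
    g∈ : ∀ {w} → w ∈ idPerm n → g w ∈ idPerm n
    g∘f : ∀ {v} → v ∈ idPerm n → g (f v) ≡ v
    f∘g : ∀ {w} → w ∈ idPerm n → f (g w) ≡ w

  map-g∘f : ∀ {t} → IsPerm n t → map g (map f t) ≡ t
  map-g∘f {t} pt = trans (sym (map-∘ t)) (map-id-local (All.tabulate λ v∈ → g∘f (↭.∈-resp-↭ pt v∈)))

  map-f∘g : ∀ {t} → IsPerm n t → map f (map g t) ≡ t
  map-f∘g {t} pt = trans (sym (map-∘ t)) (map-id-local (All.tabulate λ w∈ → f∘g (↭.∈-resp-↭ pt w∈)))

InverseOn-fromMaps : ∀ {n l q} {f g : ℕ → ℕ} → IsPerm n l → IsPerm n q → map f l ≡ q → map g q ≡ l → InverseOn n f g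
InverseOn-fromMaps {n} {l} {q} {f} {g} pl pq fl≡q gq≡l = record
  { f∈ = λ v∈ → ↭.∈-resp-↭ pq (subst (_ ∈_) fl≡q (∈-map⁺ f (toL v∈)))
  ; g∈ = λ w∈ → ↭.∈-resp-↭ pl (subst (_ ∈_) gq≡l (∈-map⁺ g (toQ w∈)))
  ; g∘f = λ v∈ → map-id⁻ l (trans (map-∘ l) (trans (cong (map g) fl≡q) gq≡l)) (toL v∈)
  ; f∘g = λ w∈ → map-id⁻ q (trans (map-∘ q) (trans (cong (map f) gq≡l) fl≡q)) (toQ w∈) }
  where
  toL : ∀ {v} → v ∈ idPerm n → v ∈ l
  toL = ↭.∈-resp-↭ (↭-sym pl)
  toQ : ∀ {v} → v ∈ idPerm n → v ∈ q
  toQ = ↭.∈-resp-↭ (↭-sym pq)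

-- Statistics preserved by ancestry-preserving relabellings

upDown-map : ∀ {f} l → PreservesAncestry f l → Distinct l → upDown (map f l) ≡ upDown l
upDown-map [] _ _ = refl
upDown-map (x ∷ []) _ _ = refl
upDown-map {f} (x ∷ y ∷ xs) pres (x∉ ∷ ds) = cong₂ _∷_ first (upDown-map (y ∷ xs) (PreservesAncestry-∷ pres) ds)
  where
  first : (if f x <ᵇ f y then u else d) ≡ (if x <ᵇ y then u else d)
  first with <-cmp x y
  ... | tri< x<y _ _ rewrite <⇒<ᵇ-true x<y | <⇒<ᵇ-true (pres y x (x<y , [] , inj₂ ([] , xs , refl) , [])) = refl
  ... | tri≈ _ refl _ = contradiction (here refl) x∉
  ... | tri> _ _ y<x rewrite ≮⇒<ᵇ-false (<⇒≯ y<x) | ≮⇒<ᵇ-false (<⇒≯ (pres x y (y<x , [] , inj₁ ([] , xs , refl) , []))) = refl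

-- Scanning right from x, the entries below x up to the first larger one are descendants
-- of x, and that larger one is an ancestor of x; the relabelling keeps all these comparisons.
allB<-map-after : ∀ {f x} p pre ys → PreservesAncestry f (p ++ x ∷ pre ++ ys) → Distinct (p ++ x ∷ pre ++ ys) →
  All (_< x) pre → allB (λ y → y <ᵇ f x) (map f ys) ≡ allB (λ y → y <ᵇ x) ys
allB<-map-after p pre [] _ _ _ = refl
allB<-map-after {f} {x} p pre (y ∷ ys) pres ds pre<x with <-cmp y x
... | tri< y<x _ _ rewrite <⇒<ᵇ-true y<x | <⇒<ᵇ-true (pres x y (y<x , pre , inj₁ (p , ys , refl) , pre<x)) =
  allB<-map-after p (pre ++ [ y ]) ys (subst (PreservesAncestry f) eq pres) (subst Distinct eq ds) (All.++⁺ pre<x (y<x ∷ []))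
  where
  eq : p ++ x ∷ pre ++ y ∷ ys ≡ p ++ x ∷ (pre ++ [ y ]) ++ ys
  eq = cong (λ z → p ++ x ∷ z) (sym (++-assoc pre [ y ] ys))
... | tri≈ _ refl _ = contradiction (∈-++⁺ʳ pre (here refl)) (Distinct-∉ʳ p ds)
... | tri> _ _ x<y rewrite ≮⇒<ᵇ-false (<⇒≯ x<y)
                   | ≮⇒<ᵇ-false (<⇒≯ (pres y x (x<y , pre , inj₂ (p , ys , refl) , All.map (λ z<x → <-trans z<x x<y) pre<x))) = refl

rlMaxMask-map : ∀ {f} l → PreservesAncestry f l → Distinct l → rlMaxMask (map f l) ≡ rlMaxMask l
rlMaxMask-map [] _ _ = refl
rlMaxMask-map (x ∷ xs) pres ds@(_ ∷ ds′) =
  cong₂ _∷_ (allB<-map-after [] [] xs pres ds []) (rlMaxMask-map xs (PreservesAncestry-∷ pres) ds′)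

lrMaxMaskFrom-map : ∀ {f} seen xs → PreservesAncestry f (reverse seen ++ xs) → Distinct (reverse seen ++ xs) →
  lrMaxMaskFrom (map f seen) (map f xs) ≡ lrMaxMaskFrom seen xs
lrMaxMaskFrom-map seen [] _ _ = refl
lrMaxMaskFrom-map {f} seen (x ∷ xs) pres ds =
  cong₂ _∷_ first (lrMaxMaskFrom-map (x ∷ seen) xs (subst (PreservesAncestry f) eq pres) (subst Distinct eq ds))
  where
  L = reverse seen ++ x ∷ xs
  reverse-L : reverse L ≡ reverse xs ++ x ∷ seen
  reverse-L = trans (reverse-++-∷ (reverse seen) x xs) (cong (λ z → reverse xs ++ x ∷ z) (reverse-involutive seen))
  pres-rev : PreservesAncestry f (reverse L)
  pres-rev = PreservesAncestry-reverse⁻ (subst (PreservesAncestry f) (sym (reverse-involutive L)) pres)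
  first : allB (λ y → y <ᵇ f x) (map f seen) ≡ allB (λ y → y <ᵇ x) seen
  first = allB<-map-after (reverse xs) [] seen (subst (PreservesAncestry f) reverse-L pres-rev)
            (subst Distinct reverse-L (Distinct-reverse ds)) []
  eq : reverse seen ++ x ∷ xs ≡ reverse (x ∷ seen) ++ xs
  eq = trans (sym (++-assoc (reverse seen) [ x ] xs)) (cong (_++ xs) (sym (unfold-reverse x seen)))

lrMaxMask-map : ∀ {f} l → PreservesAncestry f l → Distinct l → lrMaxMask (map f l) ≡ lrMaxMask l
lrMaxMask-map = lrMaxMaskFrom-map []

-- zeil and Rzeil

IsRLMax : List ℕ → ℕ → Set
IsRLMax L t = Σ (List ℕ) λ p → Σ (List ℕ) λ q → L ≡ p ++ t ∷ q × All (_< t) q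

RLMaxesAbove : List ℕ → ℕ → ℕ → Set
RLMaxesAbove L c N = ∀ t → c < t → t ≤ N → IsRLMax L t

RLMaxesAbove-mono : ∀ {L c c′ N} → c ≤ c′ → RLMaxesAbove L c N → RLMaxesAbove L c′ N
RLMaxesAbove-mono c≤c′ tops t c′<t = tops t (≤-<-trans c≤c′ c′<t)

IsRLMax-∈ : ∀ {L t} → IsRLMax L t → t ∈ L
IsRLMax-∈ (p , q , refl , _) = ∈-++⁺ʳ p (here refl)

IsRLMax-suffix : ∀ {L t} p q → Distinct L → L ≡ p ++ t ∷ q → IsRLMax L t → All (_< t) q
IsRLMax-suffix p q ds eq (p′ , q′ , eq′ , q′<t) =
  subst (All _) (sym (proj₂ (Distinct-split-unique p _ q p′ q′ ds eq eq′))) q′<t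

IsRLMax-++-∷⁺ : ∀ {r t} p x → IsRLMax r t → IsRLMax (p ++ x ∷ r) t
IsRLMax-++-∷⁺ {t = t} p x (p′ , q , refl , q<t) = p ++ x ∷ p′ , q , sym (++-assoc p (x ∷ p′) (t ∷ q)) , q<t

IsRLMax-++-∷⁻ : ∀ {t N} p r → Distinct (p ++ N ∷ r) → t < N → IsRLMax (p ++ N ∷ r) t → IsRLMax r t
IsRLMax-++-∷⁻ {t} {N} p r ds t<N rl with ∈-++⁻ p (IsRLMax-∈ rl)
... | inj₁ t∈p with p₁ , p₂ , refl ← ∈-∃++ t∈p =
  contradiction (All.lookup (IsRLMax-suffix p₁ (p₂ ++ N ∷ r) ds (++-assoc p₁ (t ∷ p₂) (N ∷ r)) rl) (∈-++⁺ʳ p₂ (here refl)))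
                (<-asym t<N)
... | inj₂ (here refl) = contradiction t<N (<-irrefl refl)
... | inj₂ (there t∈r) with r₁ , r₂ , refl ← ∈-∃++ t∈r =
  r₁ , r₂ , refl , IsRLMax-suffix (p ++ N ∷ r₁) r₂ ds (sym (++-assoc p (N ∷ r₁) (t ∷ r₂))) rl

¬IsRLMax-under-max : ∀ {a m α β} → Distinct (α ++ m ∷ β) → All (_< m) α → a ∈ α → ¬ IsRLMax (α ++ m ∷ β) a
¬IsRLMax-under-max {a} {m} {α} {β} ds α<m a∈ rl with a₁ , a₂ , refl ← ∈-∃++ a∈ =
  <-asym (All.lookup α<m a∈)
    (All.lookup (IsRLMax-suffix a₁ (a₂ ++ m ∷ β) ds (++-assoc a₁ (a ∷ a₂) (m ∷ β)) rl) (∈-++⁺ʳ a₂ (here refl)))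

IsRLMax-map : ∀ {f L t} → PreservesAncestry f L → Distinct L → IsRLMax L t → IsRLMax (map f L) (f t)
IsRLMax-map {f} {t = t} pres ds (p , q , refl , q<t) =
  map f p , map f q , map-++ f p (t ∷ q) ,
  allB<ᵇ-true⁻ (map f q) (trans (allB<-map-after p [] q pres ds []) (allB<ᵇ-true q q<t))

IsRLMax-map⁻ : ∀ {f L w} → PreservesAncestry f L → Distinct L → Distinct (map f L) → w ∈ L →
  IsRLMax (map f L) (f w) → IsRLMax L w
IsRLMax-map⁻ {f} {w = w} pres ds dsf w∈ rl with p , q , refl ← ∈-∃++ w∈ =
  p , q , refl , allB<ᵇ-true⁻ q (trans (sym (allB<-map-after p [] q pres ds []))
                  (allB<ᵇ-true (map f q) (IsRLMax-suffix (map f p) (map f q) dsf (map-++ f p (w ∷ q)) rl)))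

∷⊆⁻ : ∀ {x xs q} → (x ∷ xs) ⊆ q → Σ (List ℕ) λ p → Σ (List ℕ) λ r → q ≡ p ++ x ∷ r × xs ⊆ r
∷⊆⁻ (y ∷ʳ sub) with p , r , refl , sub′ ← ∷⊆⁻ sub = y ∷ p , r , refl , sub′
∷⊆⁻ (refl ∷ sub) = [] , _ , refl , sub

∷⊆⁺ : ∀ {x : ℕ} {xs} p {r} → xs ⊆ r → (x ∷ xs) ⊆ p ++ x ∷ r
∷⊆⁺ [] sub = refl ∷ sub
∷⊆⁺ (y ∷ p) sub = y ∷ʳ ∷⊆⁺ p sub

decRun-suc : ∀ N k → decRun N (suc k) ≡ N ∷ decRun (N ∸ 1) k
decRun-suc N k = cong (N ∷_) (begin
    map (λ i → N ∸ i) (applyUpTo suc k)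
  ≡⟨ cong (map (λ i → N ∸ i)) (map-upTo suc k) ⟨
    map (λ i → N ∸ i) (map suc (upTo k))
  ≡⟨ map-∘ (upTo k) ⟨
    map (λ i → N ∸ suc i) (upTo k)
  ≡⟨ map-cong (λ i → sym (∸-+-assoc N 1 i)) (upTo k) ⟩
    map (λ i → N ∸ 1 ∸ i) (upTo k)
  ∎)
  where open ≡-Reasoning

<⇒≤∸1 : ∀ {t N} → t < N → t ≤ N ∸ 1
<⇒≤∸1 {N = suc N} (s≤s t≤N) = t≤N

≤∸1⇒< : ∀ {t N} → 1 ≤ N → t ≤ N ∸ 1 → t < N
≤∸1⇒< {N = suc N} _ t≤N = s≤s t≤N

∸-suc-< : ∀ {k N} → k < N → N ∸ suc k < N
∸-suc-< {k} {suc N} _ = s≤s (m∸n≤m N k)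

after-max≤∸1 : ∀ p {N r} → Distinct (p ++ N ∷ r) → All (_≤ N) (p ++ N ∷ r) → All (_≤ N ∸ 1) r
after-max≤∸1 p ds ≤N = All.tabulate λ z∈ →
  <⇒≤∸1 (≤∧≢⇒< (All.lookup ≤N (∈-++⁺ʳ p (there z∈))) λ { refl → Distinct-∉ʳ p ds z∈ })

decRun⊆⇒RLMaxesAbove : ∀ k N q → Distinct q → All (_≤ N) q → k ≤ N → decRun N k ⊆ q → RLMaxesAbove q (N ∸ k) N
decRun⊆⇒RLMaxesAbove zero N q _ _ _ _ t N<t t≤N = contradiction t≤N (<⇒≱ N<t)
decRun⊆⇒RLMaxesAbove (suc k) N q ds q≤N k<N sub t N∸k<t t≤N
  with p , r , refl , sub′ ← ∷⊆⁻ (subst (_⊆ q) (decRun-suc N k) sub) with <-cmp t N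
... | tri≈ _ refl _ = p , r , refl , All.map (≤∸1⇒< (≤-trans (s≤s z≤n) k<N)) (after-max≤∸1 p ds q≤N)
... | tri> _ _ N<t = contradiction t≤N (<⇒≱ N<t)
... | tri< t<N _ _ = IsRLMax-++-∷⁺ p N
        (decRun⊆⇒RLMaxesAbove k (N ∸ 1) r (proj₂ (Distinct-++-∷⁻ p ds)) (after-max≤∸1 p ds q≤N) (<⇒≤∸1 k<N) sub′
          t (subst (_< t) (sym (∸-+-assoc N 1 k)) N∸k<t) (<⇒≤∸1 t<N))

RLMaxesAbove⇒decRun⊆ : ∀ k N q → Distinct q → All (_≤ N) q → k ≤ N → RLMaxesAbove q (N ∸ k) N → decRun N k ⊆ q
RLMaxesAbove⇒decRun⊆ zero N q _ _ _ _ = ⊆.[]⊆-universal q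
RLMaxesAbove⇒decRun⊆ (suc k) N q ds q≤N k<N tops with p , r , refl , _ ← tops N (∸-suc-< k<N) ≤-refl =
  subst (_⊆ p ++ N ∷ r) (sym (decRun-suc N k))
    (∷⊆⁺ p (RLMaxesAbove⇒decRun⊆ k (N ∸ 1) r (proj₂ (Distinct-++-∷⁻ p ds)) (after-max≤∸1 p ds q≤N) (<⇒≤∸1 k<N) tops-r))
  where
  tops-r : RLMaxesAbove r (N ∸ 1 ∸ k) (N ∸ 1)
  tops-r t N∸1∸k<t t≤N∸1 = IsRLMax-++-∷⁻ p r ds t<N (tops t (subst (_< t) (∸-+-assoc N 1 k) N∸1∸k<t) (<⇒≤ t<N))
    where t<N = ≤∸1⇒< (≤-trans (s≤s z≤n) k<N) t≤N∸1

stackSort-around-RLMax : ∀ {l t} → DecTree l → Distinct l → IsRLMax l t → (∀ u → u ∈ l → t < u → IsRLMax l u) →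
  Σ (List ℕ) λ p → Σ (List ℕ) λ q → stackSort l ≡ p ++ t ∷ q × All (_< t) p × All (t <_) q
stackSort-around-RLMax leaf _ rl _ with () ← IsRLMax-∈ rl
stackSort-around-RLMax {t = t} (node {α} {β} {m} α<m β<m tα tβ) ds rl larger with ∈-++⁻ α (IsRLMax-∈ rl)
... | inj₁ t∈α = contradiction rl (¬IsRLMax-under-max ds α<m t∈α)
... | inj₂ (here refl) =
  stackSort α ++ stackSort β , [] , trans (stackSort-++-∷ α β α<m β<m) (sym (++-assoc (stackSort α) (stackSort β) [ m ])) ,
  All.++⁺ (All-stackSort⁺ tα α<m) (All-stackSort⁺ tβ β<m) , []
... | inj₂ (there t∈β) with p′ , q′ , eq , p′<t , t<q′ ← stackSort-around-RLMax tβ (proj₂ (Distinct-++-∷⁻ α ds)) (IsRLMax-++-∷⁻ α β ds (All.lookup β<m t∈β) rl)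
                                    (λ u u∈ t<u → IsRLMax-++-∷⁻ α β ds (All.lookup β<m u∈) (larger u (∈-++⁺ʳ α (there u∈)) t<u)) =
  stackSort α ++ p′ , q′ ++ [ m ] , eq′ , All.++⁺ (All.tabulate sorted-α<t) p′<t , All.++⁺ t<q′ (t<m ∷ [])
  where
  t<m = All.lookup β<m t∈β
  eq′ : stackSort (α ++ m ∷ β) ≡ (stackSort α ++ p′) ++ t ∷ q′ ++ [ m ]
  eq′ = trans (stackSort-++-∷ α β α<m β<m) (trans (cong (λ z → stackSort α ++ z ++ [ m ]) eq)
          (trans (cong (stackSort α ++_) (++-assoc p′ (t ∷ q′) [ m ])) (sym (++-assoc (stackSort α) p′ _))))
  sorted-α<t : ∀ {a} → a ∈ stackSort α → a < t
  sorted-α<t {a} a∈ with <-cmp a t | ∈-stackSort⁻ tα a∈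
  ... | tri< a<t _ _ | _ = a<t
  ... | tri≈ _ refl _ | a∈α = contradiction (there t∈β) (Distinct-disjoint α ds a∈α)
  ... | tri> _ _ t<a | a∈α = contradiction (larger a (∈-++⁺ˡ a∈α) t<a) (¬IsRLMax-under-max ds α<m a∈α)

Segment-++ : ∀ {a b X Y} → a ∈ X → b ∈ Y → Σ (List ℕ) λ M → Segment (X ++ Y) a M b
Segment-++ {a} {b} a∈ b∈ with x₁ , x₂ , refl ← ∈-∃++ a∈ | y₁ , y₂ , refl ← ∈-∃++ b∈ =
  x₂ ++ y₁ , x₁ , y₂ , trans (++-assoc x₁ (a ∷ x₂) (y₁ ++ b ∷ y₂)) (cong (λ z → x₁ ++ a ∷ z) (sym (++-assoc x₂ y₁ (b ∷ y₂))))

-- An entry above a lying between a and b makes a leave the stack before b enters it.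
stackSort-keeps-order : ∀ {l a b z} p mid s → DecTree l → l ≡ p ++ a ∷ mid ++ b ∷ s → z ∈ mid → a < z →
  Σ (List ℕ) λ M → Segment (stackSort l) a M b
stackSort-keeps-order p mid s leaf eq _ _ = contradiction (sym eq) (++-∷-≢[] p)
stackSort-keeps-order {a = a} {b} p mid s (node {α} {β} {m} α<m β<m tα tβ) eq z∈ a<z
  rewrite stackSort-++-∷ α β α<m β<m with ++-∷-compare α m β p a (mid ++ b ∷ s) eq
... | inj₁ (e , refl , eqβ) =
  let M , seg = stackSort-keeps-order e mid s tβ eqβ z∈ a<z in M , Segment-infix (stackSort α) [ m ] seg
... | inj₂ (inj₁ (_ , refl , refl)) = contradiction (All.lookup β<m (∈-++⁺ˡ z∈)) (<-asym a<z)
... | inj₂ (inj₂ (e , refl , eq₂)) with ++-∷-compare mid b s e m β eq₂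
...   | inj₁ (e′ , refl , _) =
        let M , seg = stackSort-keeps-order p mid e′ tα refl z∈ a<z in M , Segment-infix [] (stackSort β ++ [ m ]) seg
...   | inj₂ (inj₁ (_ , refl , refl)) =
        subst (λ w → Σ (List ℕ) λ M → Segment w a M b) (++-assoc (stackSort α) (stackSort β) [ m ])
          (Segment-++ {X = stackSort α ++ stackSort β} (∈-++⁺ˡ (∈-stackSort⁺ tα (∈-++⁺ʳ p (here refl)))) (here refl))
...   | inj₂ (inj₂ (e′ , refl , refl)) =
        Segment-++ {X = stackSort α} (∈-stackSort⁺ tα (∈-++⁺ʳ p (here refl))) (∈-++⁺ˡ (∈-stackSort⁺ tβ (∈-++⁺ʳ e′ (here refl))))

module _ {n ρ} (ρ-perm : IsPerm n ρ) where

  private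
    dsρ = IsPerm⇒Distinct ρ-perm
    tρ = Distinct⇒DecTree dsρ
    dsS : Distinct (stackSort ρ)
    dsS = Distinct-resp-↭ (↭-sym (stackSort-↭ tρ)) dsρ
    ≤n : ∀ {v} → v ∈ ρ → v ≤ n
    ≤n v∈ = proj₂ (∈-idPerm⁻ (↭.∈-resp-↭ ρ-perm v∈))

  stackSort-around-RLMaxesAbove : ∀ {c t} → RLMaxesAbove ρ c n → c < t → t ≤ n →
    Σ (List ℕ) λ p → Σ (List ℕ) λ q → stackSort ρ ≡ p ++ t ∷ q × All (_< t) p × All (t <_) q
  stackSort-around-RLMaxesAbove tops c<t t≤n =
    stackSort-around-RLMax tρ dsρ (tops _ c<t t≤n) (λ u u∈ t<u → tops u (<-trans c<t t<u) (≤n u∈))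

  stackSort-between-below : ∀ {t w P M Q} → RLMaxesAbove ρ t n → w < t →
    stackSort ρ ≡ P ++ t ∷ M ++ w ∷ Q → All (_< t) M
  stackSort-between-below {t} {w} {P} {M} {Q} tops w<t eq = All.tabulate below
    where
    below : ∀ {z} → z ∈ M → z < t
    below {z} z∈ with <-cmp z t
    ... | tri< z<t _ _ = z<t
    ... | tri≈ _ refl _ = contradiction (∈-++⁺ˡ z∈) (Distinct-∉ʳ P (subst Distinct eq dsS))
    ... | tri> _ _ t<z with M₁ , M₂ , refl ← ∈-∃++ z∈ = contradiction (<-trans w<t t<z) (<-asym z<w)
      where
      eq′ : stackSort ρ ≡ (P ++ t ∷ M₁) ++ z ∷ M₂ ++ w ∷ Q
      eq′ = trans eq (trans (cong (λ y → P ++ t ∷ y) (++-assoc M₁ (z ∷ M₂) (w ∷ Q))) (sym (++-assoc P (t ∷ M₁) _)))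
      z≤n′ = ≤n (∈-stackSort⁻ tρ (subst (z ∈_) (sym eq′) (∈-++⁺ʳ (P ++ t ∷ M₁) (here refl))))
      z<w : z < w
      z<w with p , q , eq″ , _ , z<q ← stackSort-around-RLMaxesAbove tops t<z z≤n′ =
        All.lookup (subst (All (z <_)) (proj₂ (Distinct-split-unique p z q _ _ dsS eq″ eq′)) z<q) (∈-++⁺ʳ M₂ (here refl))

  Ancestor-or-sorted-Ancestor : ∀ {t w} → RLMaxesAbove ρ t n → IsRLMax ρ w → w < t → t ∈ ρ →
    Ancestor ρ t w ⊎ Ancestor (stackSort ρ) t w
  Ancestor-or-sorted-Ancestor {t} {w} tops (p′ , s , eqρ , s<w) w<t t∈ with ∈-++⁻ p′ (subst (t ∈_) eqρ t∈)
  ... | inj₂ (here refl) = contradiction w<t (<-irrefl refl)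
  ... | inj₂ (there t∈s) = contradiction (All.lookup s<w t∈s) (<-asym w<t)
  ... | inj₁ t∈p′ with p , mid , refl ← ∈-∃++ t∈p′ = cases mid (trans eqρ (++-assoc p (t ∷ mid) (w ∷ s)))
    where
    cases : ∀ mid → ρ ≡ p ++ t ∷ mid ++ w ∷ s → Ancestor ρ t w ⊎ Ancestor (stackSort ρ) t w
    cases mid eq with All.all? (_<? t) mid
    ... | yes mid<t = inj₁ (w<t , mid , inj₁ (p , s , eq) , mid<t)
    ... | no mid≮t with z , z∈ , z≮t ← find (All.¬All⇒Any¬ (_<? t) mid mid≮t) =
      let M , P , Q , eqS = stackSort-keeps-order p mid s tρ eq z∈ t<z in
      inj₂ (w<t , M , inj₁ (P , Q , eqS) , stackSort-between-below tops w<t eqS)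
      where
      t<z : t < z
      t<z = ≤∧≢⇒< (≮⇒≥ z≮t) λ { refl → Distinct-∉ʳ p (subst Distinct eq dsρ) (∈-++⁺ˡ z∈) }

record SortedRelabelling (n : ℕ) (ρ : List ℕ) (f g : ℕ → ℕ) : Set where
  field
    ρ-perm : IsPerm n ρ
    fρ-perm : IsPerm n (map f ρ)
    inverse : InverseOn n f g
    pres : PreservesAncestry f ρ
    pres-sorted : PreservesAncestry f (stackSort ρ)

module SortedRelabelling-properties {n ρ f g} (sr : SortedRelabelling n ρ f g) where
  open SortedRelabelling sr
  open InverseOn inverse

  private
    dsρ = IsPerm⇒Distinct ρ-perm
    dsfρ = IsPerm⇒Distinct fρ-perm
    ρ⊆ : ∀ {v} → v ∈ ρ → v ∈ idPerm n
    ρ⊆ = ↭.∈-resp-↭ ρ-perm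
    ⊆ρ : ∀ {v} → v ∈ idPerm n → v ∈ ρ
    ⊆ρ = ↭.∈-resp-↭ (↭-sym ρ-perm)
    ρ≤n : All (_≤ n) ρ
    ρ≤n = All.tabulate λ v∈ → proj₂ (∈-idPerm⁻ (ρ⊆ v∈))
    fρ≤n : All (_≤ n) (map f ρ)
    fρ≤n = All.tabulate λ v∈ → proj₂ (∈-idPerm⁻ (↭.∈-resp-↭ fρ-perm v∈))
    ≤n : ∀ {v} → v ∈ idPerm n → v ≤ n
    ≤n = proj₂ ∘ ∈-idPerm⁻

  FixedAbove : ℕ → Set
  FixedAbove c = ∀ t → c < t → t ≤ n → f t ≡ t

  f≤-FixedAbove : ∀ {t} → t ∈ idPerm n → FixedAbove t → f t ≤ t
  f≤-FixedAbove {t} t∈ fixed with <-cmp t (f t)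
  ... | tri< t<ft _ _ = contradiction t<ft (<-irrefl t≡ft)
    where t≡ft = trans (sym (g∘f t∈)) (trans (cong g (sym (fixed (f t) t<ft (≤n (f∈ t∈))))) (g∘f (f∈ t∈)))
  ... | tri≈ _ t≡ft _ = ≤-reflexive (sym t≡ft)
  ... | tri> _ _ ft<t = <⇒≤ ft<t

  -- If g t < t, then g t precedes t in stackSort ρ and is a descendant of t there, so t = f (g t) < f t ≤ t.
  fixed-at-sorted-split : ∀ {t} → t ∈ idPerm n → FixedAbove t → ∀ p q → stackSort ρ ≡ p ++ t ∷ q →
    All (_< t) p → All (t <_) q → f t ≡ t
  fixed-at-sorted-split {t} t∈ fixed p q eq p<t t<q with <-cmp (g t) t
  ... | tri≈ _ gt≡t _ = trans (cong f (sym gt≡t)) (f∘g t∈)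
  ... | tri> _ _ t<gt = contradiction t<gt (<-irrefl (trans (sym (f∘g t∈)) (fixed (g t) t<gt (≤n (g∈ t∈)))))
  ... | tri< gt<t _ _ = contradiction (≤-trans f[gt]<ft (f≤-FixedAbove t∈ fixed)) (<-irrefl (f∘g t∈))
    where
    gt∈p : g t ∈ p
    gt∈p with ∈-++⁻ p (subst (g t ∈_) eq (∈-stackSort⁺ (Distinct⇒DecTree dsρ) (⊆ρ (g∈ t∈))))
    ... | inj₁ gt∈p = gt∈p
    ... | inj₂ (here gt≡t) = contradiction gt<t (<-irrefl gt≡t)
    ... | inj₂ (there gt∈q) = contradiction (All.lookup t<q gt∈q) (<-asym gt<t)
    f[gt]<ft : f (g t) < f t
    f[gt]<ft = pres-sorted t (g t) (subst (λ z → Ancestor z t (g t)) (sym eq) (Ancestor-maxˡ q p<t gt∈p))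

  RLMaxesAbove⇒FixedAbove : ∀ c → RLMaxesAbove ρ c n → FixedAbove c
  RLMaxesAbove⇒FixedAbove c tops t c<t t≤n = go (n ∸ t) t c<t t≤n (≤-reflexive (sym (m+[n∸m]≡n t≤n)))
    where
    fixed-at : ∀ t → c < t → t ≤ n → FixedAbove t → f t ≡ t
    fixed-at t c<t t≤n fixed with p , q , eq , p<t , t<q ← stackSort-around-RLMaxesAbove ρ-perm tops c<t t≤n =
      fixed-at-sorted-split (∈-idPerm⁺ (≤-trans (s≤s z≤n) c<t) t≤n) fixed p q eq p<t t<q
    go : ∀ j t → c < t → t ≤ n → n ≤ t + j → f t ≡ t
    go zero t c<t t≤n n≤t+0 = fixed-at t c<t t≤n λ t′ t<t′ t′≤n →
      contradiction (≤-trans t′≤n (≤-trans n≤t+0 (≤-reflexive (+-identityʳ t)))) (<⇒≱ t<t′)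
    go (suc j) t c<t t≤n n≤t+1+j = fixed-at t c<t t≤n λ t′ t<t′ t′≤n →
      go j t′ (<-trans c<t t<t′) t′≤n (≤-trans n≤t+1+j (≤-trans (≤-reflexive (+-suc t j)) (+-monoˡ-≤ j t<t′)))

  decRun⊆⇒FixedAbove : ∀ j → j ≤ n → decRun n j ⊆ ρ → FixedAbove (n ∸ j)
  decRun⊆⇒FixedAbove j j≤n sub = RLMaxesAbove⇒FixedAbove (n ∸ j) (decRun⊆⇒RLMaxesAbove j n ρ dsρ ρ≤n j≤n sub)

  RLMaxesAbove-map⁺ : ∀ c → RLMaxesAbove ρ c n → RLMaxesAbove (map f ρ) c n
  RLMaxesAbove-map⁺ c tops t c<t t≤n =
    subst (IsRLMax (map f ρ)) (RLMaxesAbove⇒FixedAbove c tops t c<t t≤n) (IsRLMax-map pres dsρ (tops t c<t t≤n))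

  preimage-IsRLMax : ∀ {t} → t ∈ idPerm n → IsRLMax (map f ρ) t → IsRLMax ρ (g t)
  preimage-IsRLMax t∈ frl = IsRLMax-map⁻ pres dsρ dsfρ (⊆ρ (g∈ t∈)) (subst (IsRLMax (map f ρ)) (sym (f∘g t∈)) frl)

  -- g t < t is impossible: t is an ancestor of g t in ρ or in stackSort ρ, so t = f (g t) < f t ≤ t.
  IsRLMax-map⁻-top : ∀ {t} → t ∈ idPerm n → RLMaxesAbove ρ t n → IsRLMax (map f ρ) t → IsRLMax ρ t
  IsRLMax-map⁻-top {t} t∈ tops frl with <-cmp (g t) t
  ... | tri≈ _ gt≡t _ = subst (IsRLMax ρ) gt≡t (preimage-IsRLMax t∈ frl)
  ... | tri> _ _ t<gt =
    contradiction t<gt (<-irrefl (trans (sym (f∘g t∈)) (RLMaxesAbove⇒FixedAbove t tops (g t) t<gt (≤n (g∈ t∈)))))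
  ... | tri< gt<t _ _ =
    contradiction (≤-trans f[gt]<ft (f≤-FixedAbove t∈ (RLMaxesAbove⇒FixedAbove t tops))) (<-irrefl (f∘g t∈))
    where
    f[gt]<ft : f (g t) < f t
    f[gt]<ft with Ancestor-or-sorted-Ancestor ρ-perm tops (preimage-IsRLMax t∈ frl) gt<t (⊆ρ t∈)
    ... | inj₁ anc = pres t (g t) anc
    ... | inj₂ anc = pres-sorted t (g t) anc

  RLMaxesAbove-map⁻ : ∀ k → RLMaxesAbove (map f ρ) (n ∸ k) n → RLMaxesAbove ρ (n ∸ k) n
  RLMaxesAbove-map⁻ zero _ t n<t t≤n = contradiction t≤n (<⇒≱ n<t)
  RLMaxesAbove-map⁻ (suc k) ftops t n∸1+k<t t≤n with <-cmp (n ∸ k) t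
  ... | tri< n∸k<t _ _ = RLMaxesAbove-map⁻ k (RLMaxesAbove-mono (∸-monoʳ-≤ n (n≤1+n k)) ftops) t n∸k<t t≤n
  ... | tri> _ _ t<n∸k =
    contradiction (subst (t ≤_) (trans (∸-+-assoc n k 1) (cong (n ∸_) (+-comm k 1))) (<⇒≤∸1 t<n∸k)) (<⇒≱ n∸1+k<t)
  ... | tri≈ _ refl _ =
    IsRLMax-map⁻-top (∈-idPerm⁺ (≤-trans (s≤s z≤n) n∸1+k<t) (m∸n≤m n k))
      (RLMaxesAbove-map⁻ k (RLMaxesAbove-mono (∸-monoʳ-≤ n (n≤1+n k)) ftops)) (ftops _ n∸1+k<t t≤n)

  decRun⊆-map⁺ : ∀ k → k ≤ n → decRun n k ⊆ ρ → decRun n k ⊆ map f ρ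
  decRun⊆-map⁺ k k≤n sub = RLMaxesAbove⇒decRun⊆ k n (map f ρ) dsfρ fρ≤n k≤n
    (RLMaxesAbove-map⁺ (n ∸ k) (decRun⊆⇒RLMaxesAbove k n ρ dsρ ρ≤n k≤n sub))

  decRun⊆-map⁻ : ∀ k → k ≤ n → decRun n k ⊆ map f ρ → decRun n k ⊆ ρ
  decRun⊆-map⁻ k k≤n sub = RLMaxesAbove⇒decRun⊆ k n ρ dsρ ρ≤n k≤n
    (RLMaxesAbove-map⁻ k (decRun⊆⇒RLMaxesAbove k n (map f ρ) dsfρ fρ≤n k≤n sub))

∈-decRun⁻ : ∀ {n j x} → x ∈ decRun n j → j ≤ n → n ∸ j < x × x ≤ n
∈-decRun⁻ {n} {j} x∈ j≤n with i , i∈ , refl ← ∈-map⁻ (λ i → n ∸ i) x∈ = ∸-monoʳ-< (∈-upTo⁻ i∈) j≤n , m∸n≤m n i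

decRun-too-long : ∀ {n k L} → IsPerm n L → n < k → ¬ decRun n k ⊆ L
decRun-too-long {n} {k} p n<k sub = contradiction (proj₁ (∈-idPerm⁻ (↭.∈-resp-↭ p (⊆-lookup sub 0∈)))) λ ()
  where 0∈ = subst (_∈ decRun n k) (n∸n≡0 n) (∈-map⁺ (λ i → n ∸ i) (∈-upTo⁺ n<k))

maxL-IsPerm : ∀ {n L} → IsPerm n L → maxL L ≡ n
maxL-IsPerm {zero} {[]} _ = refl
maxL-IsPerm {zero} {x ∷ L} p with () ← ↭.∈-resp-↭ p (here {xs = L} refl)
maxL-IsPerm {suc n} {[]} p with () ← ↭.∈-resp-↭ (↭-sym p) (∈-idPerm⁺ {suc n} {suc n} (s≤s z≤n) ≤-refl)
maxL-IsPerm {suc n} {x ∷ L} p = ≤-antisym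
  (proj₂ (∈-idPerm⁻ (↭.∈-resp-↭ p (maxL-∈ x L))))
  (∈⇒≤maxL (x ∷ L) (↭.∈-resp-↭ (↭-sym p) (∈-idPerm⁺ {suc n} {suc n} (s≤s z≤n) ≤-refl)))

maxWhere-run-cong : ∀ {n θ θ′} (run : ℕ → ℕ → List ℕ) → (∀ {k L} → IsPerm n L → n < k → ¬ run n k ⊆ L) →
  IsPerm n θ → IsPerm n θ′ → (∀ k → k ≤ n → run n k ⊆ θ′ ⇔ run n k ⊆ θ) →
  maxWhere (length θ′) (λ k → does (run (maxL θ′) k ⊆? θ′)) ≡ maxWhere (length θ) (λ k → does (run (maxL θ) k ⊆? θ))
maxWhere-run-cong {n} {θ} {θ′} run too-long pθ pθ′ equiv = begin
    maxWhere (length θ′) (λ k → does (run (maxL θ′) k ⊆? θ′))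
  ≡⟨ cong₂ (λ ℓ N → maxWhere ℓ (λ k → does (run N k ⊆? θ′))) (IsPerm-length pθ′) (maxL-IsPerm pθ′) ⟩
    maxWhere n (λ k → does (run n k ⊆? θ′))
  ≡⟨ cong maxL (map-cong (λ k → cong (λ b → if b then k else 0) (does-run k)) (upTo (suc n))) ⟩
    maxWhere n (λ k → does (run n k ⊆? θ))
  ≡⟨ cong₂ (λ ℓ N → maxWhere ℓ (λ k → does (run N k ⊆? θ))) (IsPerm-length pθ) (maxL-IsPerm pθ) ⟨
    maxWhere (length θ) (λ k → does (run (maxL θ) k ⊆? θ))
  ∎
  where
  open ≡-Reasoning
  does-run : ∀ k → does (run n k ⊆? θ′) ≡ does (run n k ⊆? θ)
  does-run k with k ≤? n
  ... | yes k≤n = does-⇔ (equiv k k≤n) (run n k ⊆? θ′) (run n k ⊆? θ)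
  ... | no k≰n = does-⇔ (mk⇔ (λ sub → contradiction sub (too-long pθ′ (≰⇒> k≰n)))
                              (λ sub → contradiction sub (too-long pθ (≰⇒> k≰n))))
                        (run n k ⊆? θ′) (run n k ⊆? θ)

zeil-map : ∀ {n θ f g} → SortedRelabelling n θ f g → zeil (map f θ) ≡ zeil θ
zeil-map {n} sr = maxWhere-run-cong decRun decRun-too-long ρ-perm fρ-perm
  (λ k k≤n → mk⇔ (decRun⊆-map⁻ k k≤n) (decRun⊆-map⁺ k k≤n))
  where
  open SortedRelabelling sr
  open SortedRelabelling-properties sr

IsLRMax : List ℕ → ℕ → Set
IsLRMax L t = Σ (List ℕ) λ p → Σ (List ℕ) λ q → L ≡ p ++ t ∷ q × All (_< t) p

IsLRMax-prefix : ∀ {L t} p q → Distinct L → L ≡ p ++ t ∷ q → IsLRMax L t → All (_< t) p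
IsLRMax-prefix p q ds eq (p′ , q′ , eq′ , p′<t) =
  subst (All _) (sym (proj₁ (Distinct-split-unique p _ q p′ q′ ds eq eq′))) p′<t

IsLRMax-++-∷⁻ : ∀ α {m β v} → Distinct (α ++ m ∷ β) → v ∈ α → IsLRMax (α ++ m ∷ β) v → IsLRMax α v
IsLRMax-++-∷⁻ α {m} {β} {v} ds v∈ lr with a₁ , a₂ , refl ← ∈-∃++ v∈ =
  a₁ , a₂ , refl , IsLRMax-prefix a₁ (a₂ ++ m ∷ β) ds (++-assoc a₁ (v ∷ a₂) (m ∷ β)) lr

IsRLMax-reverse⁻ : ∀ {L t} → IsRLMax (reverse L) t → IsLRMax L t
IsRLMax-reverse⁻ {L} {t} (p , q , eq , q<t) =
  reverse q , reverse p , trans (sym (reverse-involutive L)) (trans (cong reverse eq) (reverse-++-∷ p t q)) , All-reverse q<t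

IsLRMax-reverse⁺ : ∀ {L t} → IsLRMax L t → IsRLMax (reverse L) t
IsLRMax-reverse⁺ {t = t} (p , q , refl , p<t) = reverse q , reverse p , reverse-++-∷ p t q , All-reverse p<t

IsLRMax-stackSort : ∀ {l c} → DecTree l → Distinct l → (∀ v → v ∈ l → c < v → IsLRMax l v) →
  ∀ v → v ∈ stackSort l → c < v → IsLRMax (stackSort l) v
IsLRMax-stackSort leaf _ _ _ () _
IsLRMax-stackSort {c = c} (node {α} {β} {m} α<m β<m tα tβ) ds larger v v∈ c<v
  rewrite stackSort-++-∷ α β α<m β<m with ∈-++⁻ (stackSort α) v∈
... | inj₁ v∈α with p , q , eq , p<v ← IsLRMax-stackSort tα (proj₁ (Distinct-++-∷⁻ α ds))
                                          (λ v v∈ c<v → IsLRMax-++-∷⁻ α ds v∈ (larger v (∈-++⁺ˡ v∈) c<v)) v v∈α c<v =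
  p , q ++ stackSort β ++ [ m ] , trans (cong (_++ _) eq) (++-assoc p (v ∷ q) _) , p<v
... | inj₂ v∈β+m with ∈-++⁻ (stackSort β) v∈β+m
...   | inj₂ (here refl) = stackSort α ++ stackSort β , [] , sym (++-assoc (stackSort α) (stackSort β) [ m ]) ,
          All.++⁺ (All-stackSort⁺ tα α<m) (All-stackSort⁺ tβ β<m)
...   | inj₁ v∈β with b₁ , b₂ , refl ← ∈-∃++ (∈-stackSort⁻ tβ v∈β) =
          contradiction (All.lookup β<m (∈-stackSort⁻ tβ v∈β))
            (<-asym (All.lookup (IsLRMax-prefix (α ++ m ∷ b₁) b₂ ds (sym (++-assoc α (m ∷ b₁) (v ∷ b₂)))
                                   (larger v (∈-++⁺ʳ α (there (∈-stackSort⁻ tβ v∈β))) c<v))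
                                 (∈-++⁺ʳ α (here refl))))

incRun⊆⇒decRun⊆ : ∀ {n j L} → incRun n j ⊆ L → decRun n j ⊆ reverse L
incRun⊆⇒decRun⊆ {n} {j} sub = subst (_⊆ _) (reverse-involutive (decRun n j)) (⊆.reverse⁺ sub)

decRun⊆⇒incRun⊆ : ∀ {n j L} → decRun n j ⊆ reverse L → incRun n j ⊆ L
decRun⊆⇒incRun⊆ {n} {j} {L} sub = subst (incRun n j ⊆_) (reverse-involutive L) (⊆.reverse⁺ sub)

incRun⊆-stackSort : ∀ {n j L} → IsPerm n L → j ≤ n → incRun n j ⊆ L → incRun n j ⊆ stackSort L
incRun⊆-stackSort {n} {j} {L} p j≤n sub =
  decRun⊆⇒incRun⊆ (RLMaxesAbove⇒decRun⊆ j n (reverse (stackSort L)) (Distinct-reverse dsS) (All-reverse S≤n) j≤n tops-S)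
  where
  dsL = IsPerm⇒Distinct p
  tL = Distinct⇒DecTree dsL
  pS : IsPerm n (stackSort L)
  pS = ↭-trans (stackSort-↭ tL) p
  dsS = IsPerm⇒Distinct pS
  ≤n : ∀ {L} → IsPerm n L → All (_≤ n) L
  ≤n p = All.tabulate λ v∈ → proj₂ (∈-idPerm⁻ (↭.∈-resp-↭ p v∈))
  S≤n = ≤n pS
  tops : RLMaxesAbove (reverse L) (n ∸ j) n
  tops = decRun⊆⇒RLMaxesAbove j n (reverse L) (Distinct-reverse dsL) (All-reverse (≤n p)) j≤n (incRun⊆⇒decRun⊆ sub)
  tops-S : RLMaxesAbove (reverse (stackSort L)) (n ∸ j) n
  tops-S t n∸j<t t≤n = IsLRMax-reverse⁺ (IsLRMax-stackSort tL dsL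
    (λ v v∈ n∸j<v → IsRLMax-reverse⁻ (tops v n∸j<v (All.lookup (≤n p) v∈)))
    t (↭.∈-resp-↭ (↭-sym pS) (∈-idPerm⁺ (≤-trans (s≤s z≤n) n∸j<t) t≤n)) n∸j<t)

incRun⊆-stackSort^ : ∀ k {n j L} → IsPerm n L → j ≤ n → incRun n j ⊆ L → incRun n j ⊆ apply (replicate k S) L
incRun⊆-stackSort^ zero _ _ sub = sub
incRun⊆-stackSort^ (suc k) {L = L} p j≤n sub =
  incRun⊆-stackSort (↭-trans (apply-↭ (replicate k S) (IsPerm⇒Distinct p)) p) j≤n (incRun⊆-stackSort^ k p j≤n sub)

incRun-too-long : ∀ {n k L} → IsPerm n L → n < k → ¬ incRun n k ⊆ L
incRun-too-long {L = L} p n<k sub = decRun-too-long (↭-trans (↭.↭-reverse L) p) n<k (incRun⊆⇒decRun⊆ sub)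

map-incRun : ∀ {n j} {h : ℕ → ℕ} → j ≤ n → (∀ t → n ∸ j < t → t ≤ n → h t ≡ t) → map h (incRun n j) ≡ incRun n j
map-incRun {n} {j} j≤n fixed = map-id-local (All.tabulate λ x∈ →
  let bounds = ∈-decRun⁻ (↭.∈-resp-↭ (↭.↭-reverse (decRun n j)) x∈) j≤n in fixed _ (proj₁ bounds) (proj₂ bounds))

Rzeil-map : ∀ {n θ f g} k → IsPerm n θ → IsPerm n (map f θ) →
  SortedRelabelling n (reverse (apply (replicate k S) θ)) f g →
  apply (replicate k S) (map f θ) ≡ map f (apply (replicate k S) θ) → Rzeil (map f θ) ≡ Rzeil θ
Rzeil-map {n} {θ} {f} {g} k pθ pfθ sr comm =
  maxWhere-run-cong incRun incRun-too-long pθ pfθ λ j j≤n → mk⇔ (incRun⊆-map⁻ j j≤n) (incRun⊆-map⁺ j j≤n)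
  where
  open SortedRelabelling-properties sr
  open InverseOn (SortedRelabelling.inverse sr)
  σ = apply (replicate k S) θ
  incRun⊆-map⁺ : ∀ j → j ≤ n → incRun n j ⊆ θ → incRun n j ⊆ map f θ
  incRun⊆-map⁺ j j≤n sub = subst (_⊆ map f θ) (map-incRun j≤n fixed) (⊆.map⁺ f sub)
    where fixed = decRun⊆⇒FixedAbove j j≤n (incRun⊆⇒decRun⊆ (incRun⊆-stackSort^ k pθ j≤n sub))
  incRun⊆-map⁻ : ∀ j → j ≤ n → incRun n j ⊆ map f θ → incRun n j ⊆ θ
  incRun⊆-map⁻ j j≤n sub = subst₂ _⊆_ (map-incRun j≤n g-fixed) (map-g∘f pθ) (⊆.map⁺ g sub)
    where
    in-fσ : incRun n j ⊆ map f σ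
    in-fσ = subst (incRun n j ⊆_) comm (incRun⊆-stackSort^ k pfθ j≤n sub)
    in-fρ : decRun n j ⊆ map f (reverse σ)
    in-fρ = subst (decRun n j ⊆_) (sym (reverse-map f σ)) (incRun⊆⇒decRun⊆ in-fσ)
    fixed = decRun⊆⇒FixedAbove j j≤n (decRun⊆-map⁻ j j≤n in-fρ)
    g-fixed : ∀ t → n ∸ j < t → t ≤ n → g t ≡ t
    g-fixed t n∸j<t t≤n = trans (cong g (sym (fixed t n∸j<t t≤n))) (g∘f (∈-idPerm⁺ (≤-trans (s≤s z≤n) n∸j<t) t≤n))

-- The map Φ_A

module Φ-properties (A : Comp) {n θ} (θ-perm : IsPerm n θ) (sorted : SortedBy A n θ) where

  π = apply A θ
  dsθ = IsPerm⇒Distinct θ-perm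
  dsπ = Distinct-apply A dsθ

  π-perm : IsPerm n π
  π-perm = ↭-trans (apply-↭ A dsθ) θ-perm

  π-length : length π ≡ n
  π-length = IsPerm-length π-perm

  π-sortable : StackSortable π
  π-sortable = trans sorted (cong idPerm (sym π-length))

  P-perm : IsPerm n (P π)
  P-perm = subst (λ k → P π ↭ idPerm k) π-length (P-↭idPerm dsπ π-sortable)

  pres-π : PreservesAncestry (lam π) π
  pres-π = SameShape-map⇒PreservesAncestry (SameShape-P dsπ π-sortable) (map-lam dsπ)

  pres-θ : PreservesAncestry (lam π) θ
  pres-θ = proj₁ (apply-map A dsθ pres-π)

  apply-Φ : apply A (Φ A θ) ≡ P π
  apply-Φ = trans (proj₂ (apply-map A dsθ pres-π)) (map-lam dsπ)

  inverse : InverseOn n (lam π) (lamInv π)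
  inverse = InverseOn-fromMaps π-perm P-perm (map-lam dsπ) (map-lamInv dsπ π-sortable)

  Φ-perm : IsPerm n (Φ A θ)
  Φ-perm = ↭-trans (↭.map⁺ (lam π) (↭-sym (apply-↭ A dsθ))) (subst (_↭ idPerm n) (sym (map-lam dsπ)) P-perm)

Φ-sorted : ∀ A n θ → IsPerm n θ → SortedBy A n θ → IsPerm n (Φ A θ) × SortedBy (R ∷ A) n (Φ A θ)
Φ-sorted A n θ θ-perm sorted = Φ-perm , (begin
    stackSort (reverse (apply A (Φ A θ)))
  ≡⟨ cong (stackSort ∘ reverse) apply-Φ ⟩
    stackSort (reverse (P π))
  ≡⟨ StackSortable-reverse-P dsπ π-sortable ⟩
    idPerm (length (reverse (P π)))
  ≡⟨ cong idPerm (trans (length-reverse-P π) π-length) ⟩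
    idPerm n
  ∎)
  where
  open ≡-Reasoning
  open Φ-properties A θ-perm sorted

Φ-injective : ∀ A n θ θ′ → IsPerm n θ → SortedBy A n θ → IsPerm n θ′ → SortedBy A n θ′ → Φ A θ ≡ Φ A θ′ → θ ≡ θ′
Φ-injective A n θ θ′ θ-perm sorted θ′-perm sorted′ eq = begin
    θ
  ≡⟨ map-g∘f θ-perm ⟨
    map (lamInv π) (Φ A θ)
  ≡⟨ cong (map (lamInv π)) (trans eq (cong (λ z → map (lam z) θ′) (sym π≡π′))) ⟩
    map (lamInv π) (map (lam π) θ′)
  ≡⟨ map-g∘f θ′-perm ⟩
    θ′
  ∎
  where
  open ≡-Reasoning
  module Θ = Φ-properties A θ-perm sorted
  module Θ′ = Φ-properties A θ′-perm sorted′
  open Θ using (π)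
  open InverseOn Θ.inverse
  π≡π′ : π ≡ Θ′.π
  π≡π′ = P-injective Θ.dsπ Θ.π-sortable Θ′.dsπ Θ′.π-sortable (trans (sym Θ.apply-Φ) (trans (cong (apply A) eq) Θ′.apply-Φ))

Φ-preimage : ∀ A n τ → IsPerm n τ → ∀ {π} → Distinct π → StackSortable π → P π ≡ apply A τ →
  IsPerm n (map (lamInv π) τ) × SortedBy A n (map (lamInv π) τ) × Φ A (map (lamInv π) τ) ≡ τ
Φ-preimage A n τ τ-perm {π} dsπ π-sortable Pπ≡κ =
  θ-perm , trans (cong stackSort Aθ≡π) (trans π-sortable (cong idPerm π-length)) , Φθ≡τ
  where
  dsτ = IsPerm⇒Distinct τ-perm
  g = lamInv π
  θ = map g τ
  κ-back : map g (apply A τ) ≡ π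
  κ-back = trans (cong (map g) (sym Pπ≡κ)) (map-lamInv dsπ π-sortable)
  pres-κ : PreservesAncestry g (apply A τ)
  pres-κ = SameShape-map⇒PreservesAncestry (subst (λ z → SameShape z π) Pπ≡κ (SameShape-sym (SameShape-P dsπ π-sortable))) κ-back
  Aθ≡π : apply A θ ≡ π
  Aθ≡π = trans (proj₂ (apply-map A dsτ pres-κ)) κ-back
  π-length : length π ≡ n
  π-length = trans (sym (length-P π)) (trans (cong length Pπ≡κ) (IsPerm-length (↭-trans (apply-↭ A dsτ) τ-perm)))
  π-perm : IsPerm n π
  π-perm = subst (λ k → π ↭ idPerm k) π-length (StackSortable⇒↭idPerm (Distinct⇒DecTree dsπ) π-sortable)
  θ-perm : IsPerm n θ
  θ-perm = ↭-trans (↭.map⁺ g (↭-sym (apply-↭ A dsτ))) (subst (_↭ idPerm n) (sym κ-back) π-perm)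
  open InverseOn (InverseOn-fromMaps π-perm (subst (λ k → P π ↭ idPerm k) π-length (P-↭idPerm dsπ π-sortable))
                                     (map-lam dsπ) (map-lamInv dsπ π-sortable))
  Φθ≡τ : Φ A θ ≡ τ
  Φθ≡τ = trans (cong (λ z → map (lam z) θ) Aθ≡π) (map-f∘g τ-perm)

Φ-surjective : ∀ A n τ → IsPerm n τ → SortedBy (R ∷ A) n τ → Σ (List ℕ) λ θ → IsPerm n θ × SortedBy A n θ × Φ A θ ≡ τ
Φ-surjective A n τ τ-perm sorted =
  let π , dsπ , π-sortable , Pπ≡κ = P-surjective dsκ κ-reverse-sortable
  in map (lamInv π) τ , Φ-preimage A n τ τ-perm dsπ π-sortable Pπ≡κ
  where
  dsτ = IsPerm⇒Distinct τ-perm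
  dsκ = Distinct-apply A dsτ
  κ-reverse-sortable : StackSortable (reverse (apply A τ))
  κ-reverse-sortable =
    trans sorted (cong idPerm (sym (trans (length-reverse (apply A τ)) (IsPerm-length (↭-trans (apply-↭ A dsτ) τ-perm)))))

Φ-statistics : ∀ A n θ → IsPerm n θ → SortedBy A n θ →
  (rlMaxMask (Φ A θ) ≡ rlMaxMask θ) × (lrMaxMask (Φ A θ) ≡ lrMaxMask θ) × (upDown (Φ A θ) ≡ upDown θ)
Φ-statistics A n θ θ-perm sorted = rlMaxMask-map θ pres-θ dsθ , lrMaxMask-map θ pres-θ dsθ , upDown-map θ pres-θ dsθ
  where open Φ-properties A θ-perm sorted

Φ-zeil : ∀ A n A₀ → A ≡ A₀ ++ S ∷ [] → ∀ θ → IsPerm n θ → SortedBy A n θ → zeil (Φ A θ) ≡ zeil θ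
Φ-zeil A n A₀ refl θ θ-perm sorted = zeil-map record
  { ρ-perm = θ-perm ; fρ-perm = Φ-perm ; inverse = inverse ; pres = pres-θ
  ; pres-sorted = proj₁ (apply-map A₀ (Distinct-apply (S ∷ []) dsθ) (subst (PreservesAncestry (lam π)) (apply-++ A₀ _ θ) pres-π)) }
  where open Φ-properties A θ-perm sorted

Φ-Rzeil : ∀ A n B₀ k → A ≡ B₀ ++ S ∷ R ∷ replicate k S → ∀ θ → IsPerm n θ → SortedBy A n θ → Rzeil (Φ A θ) ≡ Rzeil θ
Φ-Rzeil A n B₀ k refl θ θ-perm sorted = Rzeil-map k θ-perm Φ-perm record
  { ρ-perm = ↭-trans (↭.↭-reverse σ) σ-perm ; fρ-perm = ↭-trans (↭.map⁺ (lam π) (↭-trans (↭.↭-reverse σ) (apply-↭ Sᵏ dsθ))) Φ-perm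
  ; inverse = inverse ; pres = pres-ρ ; pres-sorted = pres-Sρ } (proj₂ (apply-map Sᵏ dsθ (PreservesAncestry-reverse⁻ pres-ρ)))
  where
  open Φ-properties A θ-perm sorted
  Sᵏ = replicate k S
  σ = apply Sᵏ θ
  σ-perm = ↭-trans (apply-↭ Sᵏ dsθ) θ-perm
  dsρ = Distinct-reverse (Distinct-apply Sᵏ dsθ)
  pres-Sρ : PreservesAncestry (lam π) (stackSort (reverse σ))
  pres-Sρ = proj₁ (apply-map B₀ (Distinct-apply (S ∷ []) dsρ)
                     (subst (PreservesAncestry (lam π)) (apply-++ B₀ (S ∷ R ∷ Sᵏ) θ) pres-π))
  pres-ρ = PreservesAncestry-stackSort⁻ (Distinct⇒DecTree dsρ) pres-Sρ

theorem4p13 : (A : Comp) (n : ℕ) →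
    ((θ : List ℕ) → IsPerm n θ → SortedBy A n θ →
       IsPerm n (Φ A θ) × SortedBy (R ∷ A) n (Φ A θ))
    × ((θ θ′ : List ℕ) → IsPerm n θ → SortedBy A n θ →
         IsPerm n θ′ → SortedBy A n θ′ → Φ A θ ≡ Φ A θ′ → θ ≡ θ′)
    × ((τ : List ℕ) → IsPerm n τ → SortedBy (R ∷ A) n τ →
         Σ (List ℕ) (λ θ → IsPerm n θ × SortedBy A n θ × Φ A θ ≡ τ))
    × ((θ : List ℕ) → IsPerm n θ → SortedBy A n θ →
         (rlMaxMask (Φ A θ) ≡ rlMaxMask θ)
         × (lrMaxMask (Φ A θ) ≡ lrMaxMask θ)
         × (upDown (Φ A θ) ≡ upDown θ))
    × ((A₀ : Comp) → A ≡ A₀ ++ (S ∷ []) →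
         (θ : List ℕ) → IsPerm n θ → SortedBy A n θ → zeil (Φ A θ) ≡ zeil θ)
    × ((B₀ : Comp) (k : ℕ) → k ≥ 1 → A ≡ B₀ ++ (S ∷ R ∷ replicate k S) →
         (θ : List ℕ) → IsPerm n θ → SortedBy A n θ → Rzeil (Φ A θ) ≡ Rzeil θ)
theorem4p13 A n =
  Φ-sorted A n , Φ-injective A n , Φ-surjective A n , Φ-statistics A n , Φ-zeil A n ,
  λ B₀ k _ → Φ-Rzeil A n B₀ k
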